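{- Let $n\ge1$, $w\in\mathfrak{S}_{n+1}$, $\sigma\in\operatorname{Sym}(n)$, and let $Y=\operatorname{Ino}(w,\sigma)$. Then $\sigma$ is a linear extension of the poset $P_{w,Y}$, i.e. $a\prec_{P_{w,Y}} b$ implies $\sigma^{ -1}(a)<\sigma^{ -1}(b)$. Moreover $\lambda(w,\sigma)=\big(\Lambda(\sigma(1)),\dots,\Lambda(\sigma(n))\big)$, where $\Lambda$ is the vertex-labeling of $P_{w,Y}$.
   Context: $\operatorname{Sym}(n)$ is the set of permutations of $\{1,\dots,n\}$. For $w\in\mathfrak{S}_{n+1}$ in one-line notation $w_1\cdots w_{n+1}$ and $\sigma\in\operatorname{Sym}(n)$: start with the set composition $\{w_1\}|\cdots|\{w_{n+1}\}$ of $\{1,\dots,n+1\}$, bar $j$ ($1\le j\le n$) being the separator between $w_j$ and $w_{j+1}$. For $k=1,\dots,n$, at step $k$ remove bar $\sigma(k)$, merging the two consecutive blocks $B|B'$ it separates into $B\cup B'$. Set $\lambda_k=\varepsilon\cdot\max\{\min B,\min B'\}$ with $\varepsilon=+1$ if $\min B<\min B'$ and $\varepsilon=-1$ otherwise; $\lambda(w,\sigma)=(\lambda_1,\dots,\lambda_n)$, and $\operatorname{Ino}(w,\sigma)=\{\lambda_k:\lambda_k>0\}$. The poset $P_{w,Y}$: let $Y$ be a set of values of $w$ containing no left-to-right minimum of $w$ and containing every right-to-left minimum of $w$ other than $1$. For a position $i$ put $\ell=\max\{j<i:w_j<w_i\}$ and $r=\min\{j>i:w_j<w_i\}$ (when they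 exist). A poset $P=P_{w,Y}$ on the bar set $\{1,\dots,n\}$ (the transitive closure of the cover relations added below, starting with no relations) and an injective labeling $\Lambda:\{1,\dots,n\}\to\mathbb{Z}$ are built by processing the values $v=n+1,n,\dots,2$ in this order; let $i$ be the position with $w_i=v$. If $w_i$ is not a left-to-right minimum, let $a$ be the unique maximal element, in the poset built so far, of the set $\{\ell,\dots,i-1\}$ (which is connected with a unique maximum); if $w_i$ is not a right-to-left minimum, let $b$ be the unique maximal element of $\{i,\dots,r-1\}$. If $w_i$ is a left-to-right minimum (hence not a right-to-left minimum), set $\Lambda(b)=-w_i$. If $w_i$ is a right-to-left minimum (hence not a left-to-right minimum), set $\Lambda(a)=w_i$. If $w_i$ is neither, then: if $w_i\in Y$, add the cover relation $a\prec b$ and set $\Lambda(a)=w_i$; if $w_i\notin Y$, add $b\prec a$ and set $\Lambda(b)=-w_i$. -}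

module Defs where

open import Data.Bool using (Bool; true; false; _∨_; _∧_; not; if_then_else_; T)
import Data.Nat
open import Data.Nat using (ℕ; zero; suc; _∸_; _<ᵇ_; _≡ᵇ_; _⊓_; _<?_)
open import Data.Fin using (Fin; toℕ; fromℕ<)
open import Data.Fin.Permutation using (Permutation′; _⟨$⟩ʳ_)
open import Data.Integer as ℤ using (ℤ; +_; -_)
open import Data.Bool.ListAction using (any; all)
open import Data.List using (List; applyUpTo; reverse; foldl; _∷_; [])
open import Relation.Nullary using (does; yes; no)

-- Conventions: positions are 1..n+1, bars are 1..n, values are 1..n+1,
-- all as natural numbers (paper's 1-indexed conventions).

range : ℕ → ℕ → List ℕ
range lo hi = applyUpTo (λ t → lo Data.Nat.+ t) (suc hi ∸ lo)

firstSat : (ℕ → Bool) → List ℕ → ℕ → ℕ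
firstSat f [] d = d
firstSat f (x ∷ xs) d = if f x then x else firstSat f xs d

-- one-line notation w_1 ... w_{n+1} of a permutation of Fin (n+1)
-- (w i = 0 outside 1..n+1, never used)
oneLine : (m : ℕ) → Permutation′ m → ℕ → ℕ
oneLine m π zero = 0
oneLine m π (suc p) with p <? m
... | yes p<m = suc (toℕ (π ⟨$⟩ʳ fromℕ< p<m))
... | no _ = 0

removedBefore : (ℕ → ℕ) → ℕ → ℕ → Bool
removedBefore σ k j = any (λ k' → σ k' ≡ᵇ j) (range 1 (k ∸ 1))

-- min of w over the block (w.r.t. the removed-bar predicate rem)
-- whose right end is position p
leftMin : (ℕ → ℕ) → (ℕ → Bool) → ℕ → ℕ
leftMin w rem zero = 0
leftMin w rem (suc zero) = w 1
leftMin w rem (suc (suc p)) =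
  if rem (suc p) then w (suc (suc p)) ⊓ leftMin w rem (suc p) else w (suc (suc p))

-- min of w over the block whose left end is position p
-- (fuel m bounds the number of positions scanned)
rightMin : (ℕ → ℕ) → (ℕ → Bool) → ℕ → ℕ → ℕ
rightMin w rem zero p = w p
rightMin w rem (suc m) p =
  if rem p then w p ⊓ rightMin w rem m (suc p) else w p

-- λ_k for k ∈ 1..n : at step k bar j = σ(k) is removed, merging B|B'
lamN : ℕ → (ℕ → ℕ) → (ℕ → ℕ) → ℕ → ℤ
lamN n w σ k =
  let j   = σ k
      rem = removedBefore σ k
      mB  = leftMin w rem j
      mB' = rightMin w rem n (suc j)
  in if mB <ᵇ mB' then + mB' else - (+ mB)

inIno : ℕ → (ℕ → ℕ) → (ℕ → ℕ) → ℕ → Bool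
inIno n w σ v = any (λ k → does (lamN n w σ k ℤ.≟ + v)) (range 1 n) ∧ (0 <ᵇ v)

-- The poset P_{w,Y} and labeling Λ.  The (strict) order is stored as a
-- Boolean relation on bars, always kept transitively closed.

record PState : Set where
  field
    lt  : ℕ → ℕ → Bool
    lab : ℕ → ℤ          -- labeling Λ (0 where not yet assigned)
open PState public

-- transitive closure of (lt ∪ {a ≺ b}) for transitive lt
addCover : (ℕ → ℕ → Bool) → ℕ → ℕ → (ℕ → ℕ → Bool)
addCover lt a b x y = lt x y ∨ ((lt x a ∨ (x ≡ᵇ a)) ∧ (lt b y ∨ (b ≡ᵇ y)))

update : (ℕ → ℤ) → ℕ → ℤ → (ℕ → ℤ)
update f a z x = if x ≡ᵇ a then z else f x

-- the unique maximal element of the set of bars {lo,...,hi} w.r.t. lt,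
-- i.e. the element x of the set with y ≺ x for all other y in the set
-- (the paper guarantees it exists; default lo otherwise)
maxElem : (ℕ → ℕ → Bool) → ℕ → ℕ → ℕ
maxElem lt lo hi =
  firstSat (λ x → all (λ y → (y ≡ᵇ x) ∨ lt y x) (range lo hi)) (range lo hi) lo

stepP : ℕ → (ℕ → ℕ) → (ℕ → Bool) → PState → ℕ → PState
stepP n w Y st v =
  let i   = firstSat (λ j → w j ≡ᵇ v) (range 1 (suc n)) 0
      lrm = not (any (λ j → w j <ᵇ v) (range 1 (i ∸ 1)))
      rlm = not (any (λ j → w j <ᵇ v) (range (suc i) (suc n)))
      ℓ   = firstSat (λ j → w j <ᵇ v) (reverse (range 1 (i ∸ 1))) 0
      r   = firstSat (λ j → w j <ᵇ v) (range (suc i) (suc n)) 0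
      a   = maxElem (lt st) ℓ (i ∸ 1)
      b   = maxElem (lt st) i (r ∸ 1)
  in if lrm then record st { lab = update (lab st) b (- (+ v)) }
     else if rlm then record st { lab = update (lab st) a (+ v) }
     else if Y v then record { lt = addCover (lt st) a b ; lab = update (lab st) a (+ v) }
     else record { lt = addCover (lt st) b a ; lab = update (lab st) b (- (+ v)) }

initP : PState
initP = record { lt = λ _ _ → false ; lab = λ _ → + 0 }

buildP : ℕ → (ℕ → ℕ) → (ℕ → Bool) → PState
buildP n w Y = foldl (stepP n w Y) initP (reverse (range 2 (suc n)))

module _ (n : ℕ) (w : Permutation′ (suc n)) (σ : Permutation′ n) where
  wL : ℕ → ℕ
  wL = oneLine (suc n) w
  σL : ℕ → ℕ
  σL = oneLine n σ

  -- λ(w,σ)_k, for k ∈ Fin n standing for k+1 ∈ {1..n}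
  lam : Fin n → ℤ
  lam k = lamN n wL σL (suc (toℕ k))

  Ino : ℕ → Bool
  Ino = inIno n wL σL

  PwY : PState
  PwY = buildP n wL Ino

  _≺P_ : ℕ → ℕ → Set
  x ≺P y = T (lt PwY x y)

  Λ : ℕ → ℤ
  Λ = lab PwY

bar : {n : ℕ} → Fin n → ℕ
bar a = suc (toℕ a)

{-# OPTIONS --safe #-}
module Submission where

-- Let τ = σ⁻¹, so that bar j is removed at step τ j.  Fix a value v at position i, the nearest
-- smaller values at positions ℓ < i < r, and the bars a ∈ [ℓ, i) and b ∈ [i, r) removed last.
-- Removing a merges a block containing ℓ with the block of i; as long as b is still present
-- the latter has minimum v, so λ_{τ a} = +v when τ a < τ b.  Symmetrically λ_{τ b} = −v when
-- τ b < τ a, and if v is a left-to-right (right-to-left) minimum then b (a) carries −v (+v).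
-- A label +v at any step forces τ a < τ b, hence v ∈ Ino(w, σ) exactly when τ a < τ b: the
-- construction of P only adds covers x ≺ y with τ x < τ y, and gives the labelled bar c(v)
-- the label λ_{τ c(v)}.  The maxima it takes are the τ-latest bars, because by induction the
-- order built so far lies inside the τ-order and has a greatest element on each run of bars
-- between two smaller values.  The labels ±v are distinct, so c is a bijection onto the bars,
-- and λ_k = Λ(σ k) follows.

open import Defs
open import Data.Bool using (Bool; true; false; _∨_; _∧_; not; if_then_else_; T)
open import Data.Bool.Properties using (T-≡; not-¬)
open import Data.Bool.ListAction using (any; all)
open import Data.Nat
open import Data.Nat.Properties
open import Data.Fin as Fin using (Fin; toℕ; fromℕ<)
import Data.Fin.Properties as Fin
open import Data.Fin.Permutation using (Permutation′; _⟨$⟩ʳ_; _⟨$⟩ˡ_; flip; inverseˡ)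
open import Data.Integer as ℤ using (ℤ; +_; -_)
import Data.Integer.Properties as ℤ
open import Data.List using (applyUpTo; applyDownFrom; reverse; foldl)
open import Data.List.Properties using (reverse-applyUpTo)
import Data.List.Relation.Unary.Any.Properties as Any
import Data.List.Relation.Unary.All.Properties as All
open import Data.Product as Product using (∃; _×_; _,_; proj₁; proj₂)
open import Data.Sum as Sum using (_⊎_; inj₁; inj₂)
open import Data.Empty using (⊥; ⊥-elim)
open import Function using (Injective; Equivalence; _∘_)
open import Relation.Binary using (tri<; tri≈; tri>)
open import Relation.Binary.PropositionalEquality
open import Relation.Nullary using (¬_; Dec; yes; no; does)

private
  T⇒≡true : ∀ {b} → T b → b ≡ true
  T⇒≡true = Equivalence.to T-≡

  ≡true⇒T : ∀ {b} → b ≡ true → T b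
  ≡true⇒T = Equivalence.from T-≡

<⇒<ᵇ≡true : ∀ {m n} → m < n → (m <ᵇ n) ≡ true
<⇒<ᵇ≡true = T⇒≡true ∘ <⇒<ᵇ

<ᵇ≡true⇒< : ∀ {m n} → (m <ᵇ n) ≡ true → m < n
<ᵇ≡true⇒< {m} {n} = <ᵇ⇒< m n ∘ ≡true⇒T

≤⇒<ᵇ≡false : ∀ {m n} → n ≤ m → (m <ᵇ n) ≡ false
≤⇒<ᵇ≡false {m} {n} n≤m with m <ᵇ n in eq
... | false = refl
... | true = ⊥-elim (<⇒≱ (<ᵇ≡true⇒< eq) n≤m)

<ᵇ≡false⇒≥ : ∀ {m n} → (m <ᵇ n) ≡ false → n ≤ m
<ᵇ≡false⇒≥ eq = ≮⇒≥ λ m<n → true≢false (trans (sym (<⇒<ᵇ≡true m<n)) eq)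
  where
  true≢false : true ≢ false
  true≢false ()

≡⇒≡ᵇ≡true : ∀ {m n} → m ≡ n → (m ≡ᵇ n) ≡ true
≡⇒≡ᵇ≡true {m} {n} = T⇒≡true ∘ ≡⇒≡ᵇ m n

≡ᵇ≡true⇒≡ : ∀ {m n} → (m ≡ᵇ n) ≡ true → m ≡ n
≡ᵇ≡true⇒≡ {m} {n} = ≡ᵇ⇒≡ m n ∘ ≡true⇒T

≢⇒≡ᵇ≡false : ∀ {m n} → m ≢ n → (m ≡ᵇ n) ≡ false
≢⇒≡ᵇ≡false {m} {n} m≢n with m ≡ᵇ n in eq
... | false = refl
... | true = ⊥-elim (m≢n (≡ᵇ≡true⇒≡ eq))

∨-trueˡ : ∀ {a} b → a ≡ true → (a ∨ b) ≡ true
∨-trueˡ b refl = refl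

∨-trueʳ : ∀ a {b} → b ≡ true → (a ∨ b) ≡ true
∨-trueʳ true refl = refl
∨-trueʳ false refl = refl

∨-true⁻ : ∀ a b → (a ∨ b) ≡ true → a ≡ true ⊎ b ≡ true
∨-true⁻ true b _ = inj₁ refl
∨-true⁻ false b eq = inj₂ eq

∧-true⁺ : ∀ {a b} → a ≡ true → b ≡ true → (a ∧ b) ≡ true
∧-true⁺ refl refl = refl

∧-true⁻ : ∀ a b → (a ∧ b) ≡ true → a ≡ true × b ≡ true
∧-true⁻ true true _ = refl , refl

not≡true⇒≡false : ∀ {b} → not b ≡ true → b ≡ false
not≡true⇒≡false {false} _ = refl

not≡false⇒≡true : ∀ {b} → not b ≡ false → b ≡ true
not≡false⇒≡true {true} _ = refl

¬≡true⇒≡false : ∀ b → ¬ b ≡ true → b ≡ false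
¬≡true⇒≡false false _ = refl
¬≡true⇒≡false true b≢true = ⊥-elim (b≢true refl)

if-true : ∀ {A : Set} {b} (x y : A) → b ≡ true → (if b then x else y) ≡ x
if-true x y refl = refl

if-false : ∀ {A : Set} {b} (x y : A) → b ≡ false → (if b then x else y) ≡ y
if-false x y refl = refl

does-true⁺ : ∀ {P : Set} (d : Dec P) → P → does d ≡ true
does-true⁺ (yes _) _ = refl
does-true⁺ (no ¬p) p = ⊥-elim (¬p p)

does-true⁻ : ∀ {P : Set} (d : Dec P) → does d ≡ true → P
does-true⁻ (yes p) _ = p

≤pred⇒< : ∀ {x i} → 1 ≤ i → x ≤ pred i → x < i
≤pred⇒< 1≤i = m≤pred[n]⇒suc[m]≤n {{>-nonZero 1≤i}}

suc-pred′ : ∀ {i} → 1 ≤ i → suc (pred i) ≡ i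
suc-pred′ 1≤i = suc-pred _ {{>-nonZero 1≤i}}

private
  range-index≤ : ∀ lo hi t → t < suc hi ∸ lo → lo + t ≤ hi
  range-index≤ zero hi t t< = ≤-pred t<
  range-index≤ (suc lo) zero t t< rewrite 0∸n≡0 lo with () ← t<
  range-index≤ (suc lo) (suc hi) t t< = s≤s (range-index≤ lo hi t t<)

  offset<length : ∀ {lo hi x} → lo ≤ x → x ≤ hi → x ∸ lo < suc hi ∸ lo
  offset<length lo≤x x≤hi = ∸-monoˡ-< (s≤s x≤hi) lo≤x

  at-offset : ∀ (P : ℕ → Set) {lo x} → lo ≤ x → P x → P (lo + (x ∸ lo))
  at-offset P lo≤x = subst P (sym (m+[n∸m]≡n lo≤x))

  from-offset : ∀ (P : ℕ → Set) {lo x} → lo ≤ x → P (lo + (x ∸ lo)) → P x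
  from-offset P lo≤x = subst P (m+[n∸m]≡n lo≤x)

any-range⁺ : ∀ (g : ℕ → Bool) {lo hi x} → lo ≤ x → x ≤ hi → g x ≡ true → any g (range lo hi) ≡ true
any-range⁺ g {lo} lo≤x x≤hi gx = T⇒≡true (Any.any⁺ g
  (Any.applyUpTo⁺ (λ t → lo + t) (≡true⇒T (at-offset (λ y → g y ≡ true) lo≤x gx)) (offset<length lo≤x x≤hi)))

any-range⁻ : ∀ (g : ℕ → Bool) lo hi → any g (range lo hi) ≡ true → ∃ λ x → lo ≤ x × x ≤ hi × g x ≡ true
any-range⁻ g lo hi eq with Any.applyUpTo⁻ (λ t → lo + t) (Any.any⁻ g (range lo hi) (≡true⇒T eq))
... | t , t< , gt = lo + t , m≤m+n lo t , range-index≤ lo hi t t< , T⇒≡true gt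

any-range-false : ∀ (g : ℕ → Bool) lo hi → any g (range lo hi) ≡ false → ∀ x → lo ≤ x → x ≤ hi → g x ≡ false
any-range-false g lo hi none x lo≤x x≤hi with g x in gx
... | false = refl
... | true with () ← trans (sym (any-range⁺ g lo≤x x≤hi gx)) none

all-range⁺ : ∀ (g : ℕ → Bool) lo hi → (∀ x → lo ≤ x → x ≤ hi → g x ≡ true) → all g (range lo hi) ≡ true
all-range⁺ g lo hi h = T⇒≡true (All.all⁻ g (All.applyUpTo⁺₁ (λ t → lo + t) (suc hi ∸ lo)
  λ {t} t< → ≡true⇒T (h (lo + t) (m≤m+n lo t) (range-index≤ lo hi t t<))))

all-range⁻ : ∀ (g : ℕ → Bool) lo hi → all g (range lo hi) ≡ true → ∀ x → lo ≤ x → x ≤ hi → g x ≡ true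
all-range⁻ g lo hi eq x lo≤x x≤hi = from-offset (λ y → g y ≡ true) lo≤x
  (T⇒≡true (All.applyUpTo⁻ (λ t → lo + t) (suc hi ∸ lo) (All.all⁺ g (range lo hi) (≡true⇒T eq)) (offset<length lo≤x x≤hi)))

FirstIn : (ℕ → Bool) → ℕ → ℕ → ℕ → Set
FirstIn g lo hi x = lo ≤ x × x ≤ hi × g x ≡ true × (∀ y → lo ≤ y → y < x → g y ≡ false)

LastIn : (ℕ → Bool) → ℕ → ℕ → ℕ → Set
LastIn g lo hi x = lo ≤ x × x ≤ hi × g x ≡ true × (∀ y → x < y → y ≤ hi → g y ≡ false)

private
  firstSat-applyUpTo : ∀ (g : ℕ → Bool) f {m t₀} d → t₀ < m → g (f t₀) ≡ true →
    ∃ λ t → t < m × g (f t) ≡ true × (∀ s → s < t → g (f s) ≡ false) × firstSat g (applyUpTo f m) d ≡ f t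
  firstSat-applyUpTo g f {suc m} {t₀} d t₀<m gt₀ with g (f 0) in g0
  ... | true = 0 , z<s , g0 , (λ _ ()) , refl
  ... | false with t₀
  ...   | zero with () ← trans (sym gt₀) g0
  ...   | suc t₀′ with firstSat-applyUpTo g (f ∘ suc) d (s<s⁻¹ t₀<m) gt₀
  ...     | t , t<m , gt , before , eq =
    suc t , s<s t<m , gt , (λ { zero _ → g0 ; (suc s) s<t → before s (s<s⁻¹ s<t) }) , eq

  firstSat-applyDownFrom : ∀ (g : ℕ → Bool) f {m t₀} d → t₀ < m → g (f t₀) ≡ true →
    ∃ λ t → t < m × g (f t) ≡ true × (∀ s → t < s → s < m → g (f s) ≡ false) × firstSat g (applyDownFrom f m) d ≡ f t
  firstSat-applyDownFrom g f {suc m} {t₀} d t₀<m gt₀ with g (f m) in gm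
  ... | true = m , ≤-refl , gm , (λ s m<s s<sm → ⊥-elim (<⇒≱ m<s (≤-pred s<sm))) , refl
  ... | false with m≤n⇒m<n∨m≡n (≤-pred t₀<m)
  ...   | inj₂ refl with () ← trans (sym gt₀) gm
  ...   | inj₁ t₀<m′ with firstSat-applyDownFrom g f d t₀<m′ gt₀
  ...     | t , t<m , gt , after , eq = t , m<n⇒m<1+n t<m , gt , after′ , eq
    where
    after′ : ∀ s → t < s → s < suc m → g (f s) ≡ false
    after′ s t<s s<sm with m≤n⇒m<n∨m≡n (≤-pred s<sm)
    ... | inj₁ s<m = after s t<s s<m
    ... | inj₂ refl = gm

firstSat-range : ∀ (g : ℕ → Bool) {lo hi x₀} d → lo ≤ x₀ → x₀ ≤ hi → g x₀ ≡ true →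
  FirstIn g lo hi (firstSat g (range lo hi) d)
firstSat-range g {lo} {hi} d lo≤x₀ x₀≤hi gx₀
  with firstSat-applyUpTo g (λ t → lo + t) d (offset<length lo≤x₀ x₀≤hi) (at-offset (λ y → g y ≡ true) lo≤x₀ gx₀)
... | t , t< , gt , before , eq = subst (FirstIn g lo hi) (sym eq) (m≤m+n lo t , range-index≤ lo hi t t< , gt , before′)
  where
  before′ : ∀ y → lo ≤ y → y < lo + t → g y ≡ false
  before′ y lo≤y y<x = from-offset (λ z → g z ≡ false) lo≤y
    (before (y ∸ lo) (subst (y ∸ lo <_) (m+n∸m≡n lo t) (∸-monoˡ-< y<x lo≤y)))

firstSat-reverse-range : ∀ (g : ℕ → Bool) {lo hi x₀} d → lo ≤ x₀ → x₀ ≤ hi → g x₀ ≡ true →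
  LastIn g lo hi (firstSat g (reverse (range lo hi)) d)
firstSat-reverse-range g {lo} {hi} d lo≤x₀ x₀≤hi gx₀
  rewrite reverse-applyUpTo (λ t → lo + t) (suc hi ∸ lo)
  with firstSat-applyDownFrom g (λ t → lo + t) d (offset<length lo≤x₀ x₀≤hi) (at-offset (λ y → g y ≡ true) lo≤x₀ gx₀)
... | t , t< , gt , after , eq = subst (LastIn g lo hi) (sym eq) (m≤m+n lo t , range-index≤ lo hi t t< , gt , after′)
  where
  after′ : ∀ y → lo + t < y → y ≤ hi → g y ≡ false
  after′ y x<y y≤hi = from-offset (λ z → g z ≡ false) lo≤y
    (after (y ∸ lo) (subst (_< y ∸ lo) (m+n∸m≡n lo t) (∸-monoˡ-< x<y (m≤m+n lo t))) (offset<length lo≤y y≤hi))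
    where
    lo≤y : lo ≤ y
    lo≤y = ≤-trans (m≤m+n lo t) (<⇒≤ x<y)

Fin-injective⇒surjective : ∀ {N} {g : Fin N → Fin N} → Injective _≡_ _≡_ g → ∀ y → ∃ λ t → g t ≡ y
Fin-injective⇒surjective {suc N} {g} g-injective y with Fin.any? (λ t → g t Fin.≟ y)
... | yes found = found
... | no ¬found = ⊥-elim (1+n≰n (Fin.injective⇒≤ (g-injective ∘ Fin.punchOut-injective (y≢g _) (y≢g _))))
  where
  y≢g : ∀ t → y ≢ g t
  y≢g t y≡gt = ¬found (t , sym y≡gt)

injective⇒surjective : ∀ N (f : ℕ → ℕ) → (∀ {t} → t < N → f t < N) →
  (∀ {s t} → s < N → t < N → f s ≡ f t → s ≡ t) → ∀ {x} → x < N → ∃ λ t → t < N × f t ≡ x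
injective⇒surjective N f f-bound f-injective {x} x<N
  with Fin-injective⇒surjective {N} {g} g-injective (fromℕ< x<N)
  where
  g : Fin N → Fin N
  g t = fromℕ< (f-bound (Fin.toℕ<n t))
  g-injective : Injective _≡_ _≡_ g
  g-injective {s} {t} gs≡gt = Fin.toℕ-injective (f-injective (Fin.toℕ<n s) (Fin.toℕ<n t)
    (trans (sym (Fin.toℕ-fromℕ< _)) (trans (cong toℕ gs≡gt) (Fin.toℕ-fromℕ< _))))
... | t , gt≡x = toℕ t , Fin.toℕ<n t ,
  trans (sym (Fin.toℕ-fromℕ< _)) (trans (cong toℕ gt≡x) (Fin.toℕ-fromℕ< x<N))

-- Greatest elements and added covers

IsGreatest : (ℕ → ℕ → Bool) → ℕ → ℕ → ℕ → Set
IsGreatest lt lo hi m = lo ≤ m × m ≤ hi × (∀ y → lo ≤ y → y ≤ hi → y ≡ m ⊎ lt y m ≡ true)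

IsGreatest-⊆ : ∀ {lt lt′ : ℕ → ℕ → Bool} → (∀ {x y} → lt x y ≡ true → lt′ x y ≡ true) →
  ∀ {lo hi m} → IsGreatest lt lo hi m → IsGreatest lt′ lo hi m
IsGreatest-⊆ lt⊆lt′ (lo≤m , m≤hi , greatest) = lo≤m , m≤hi , λ y lo≤y y≤hi → Sum.map₂ lt⊆lt′ (greatest y lo≤y y≤hi)

maxElem-greatest : ∀ (lt : ℕ → ℕ → Bool) → (∀ {x y} → lt x y ≡ true → lt y x ≡ true → ⊥) →
  ∀ {lo hi m} → IsGreatest lt lo hi m → maxElem lt lo hi ≡ m
maxElem-greatest lt asym {lo} {hi} {m} (lo≤m , m≤hi , greatest)
  with firstSat-range isMax lo lo≤m m≤hi (all-range⁺ _ lo hi λ y lo≤y y≤hi → below-m (greatest y lo≤y y≤hi))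
  where
  isMax : ℕ → Bool
  isMax x = all (λ y → (y ≡ᵇ x) ∨ lt y x) (range lo hi)
  below-m : ∀ {y} → y ≡ m ⊎ lt y m ≡ true → ((y ≡ᵇ m) ∨ lt y m) ≡ true
  below-m (inj₁ y≡m) = ∨-trueˡ _ (≡⇒≡ᵇ≡true y≡m)
  below-m {y} (inj₂ y≺m) = ∨-trueʳ (y ≡ᵇ m) y≺m
... | lo≤x , x≤hi , x-isMax , _ =
  antisym (greatest _ lo≤x x≤hi) (∨-true⁻ _ _ (all-range⁻ _ lo hi x-isMax m lo≤m m≤hi))
  where
  antisym : ∀ {x} → x ≡ m ⊎ lt x m ≡ true → (m ≡ᵇ x) ≡ true ⊎ lt m x ≡ true → x ≡ m
  antisym (inj₁ x≡m) _ = x≡m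
  antisym (inj₂ _) (inj₁ m≡x) = sym (≡ᵇ≡true⇒≡ m≡x)
  antisym (inj₂ x≺m) (inj₂ m≺x) = ⊥-elim (asym x≺m m≺x)

ltBy : (ℕ → ℕ) → ℕ → ℕ → Bool
ltBy τ x y = τ x <ᵇ τ y

ltBy-greatest : ∀ (τ : ℕ → ℕ) lo hi → lo ≤ hi →
  (∀ {x y} → lo ≤ x → x ≤ hi → lo ≤ y → y ≤ hi → τ x ≡ τ y → x ≡ y) →
  ∃ (IsGreatest (ltBy τ) lo hi)
ltBy-greatest τ lo zero lo≤0 _ rewrite n≤0⇒n≡0 lo≤0 = 0 , z≤n , z≤n , λ y _ y≤0 → inj₁ (n≤0⇒n≡0 y≤0)
ltBy-greatest τ lo (suc h) lo≤hi τ-inj with m≤n⇒m<n∨m≡n lo≤hi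
... | inj₂ refl = suc h , ≤-refl , ≤-refl , λ y lo≤y y≤hi → inj₁ (≤-antisym y≤hi lo≤y)
... | inj₁ lo<hi with ltBy-greatest τ lo h (≤-pred lo<hi)
                        (λ a b c d → τ-inj a (m≤n⇒m≤1+n b) c (m≤n⇒m≤1+n d))
... | m , lo≤m , m≤h , greatest with <-cmp (τ m) (τ (suc h))
... | tri< τm<τhi _ _ = suc h , <⇒≤ lo<hi , ≤-refl , new-greatest
  where
  new-greatest : ∀ y → lo ≤ y → y ≤ suc h → y ≡ suc h ⊎ ltBy τ y (suc h) ≡ true
  new-greatest y lo≤y y≤hi with m≤n⇒m<n∨m≡n y≤hi
  ... | inj₂ y≡hi = inj₁ y≡hi
  ... | inj₁ y<hi with greatest y lo≤y (≤-pred y<hi)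
  ...   | inj₁ refl = inj₂ (<⇒<ᵇ≡true τm<τhi)
  ...   | inj₂ τy<τm = inj₂ (<⇒<ᵇ≡true (<-trans (<ᵇ≡true⇒< τy<τm) τm<τhi))
... | tri≈ _ τm≡τhi _ = ⊥-elim (<⇒≢ (s≤s m≤h) (τ-inj lo≤m (m≤n⇒m≤1+n m≤h) (<⇒≤ lo<hi) ≤-refl τm≡τhi))
... | tri> _ _ τhi<τm = m , lo≤m , m≤n⇒m≤1+n m≤h , old-greatest
  where
  old-greatest : ∀ y → lo ≤ y → y ≤ suc h → y ≡ m ⊎ ltBy τ y m ≡ true
  old-greatest y lo≤y y≤hi with m≤n⇒m<n∨m≡n y≤hi
  ... | inj₂ refl = inj₂ (<⇒<ᵇ≡true τhi<τm)
  ... | inj₁ y<hi = greatest y lo≤y (≤-pred y<hi)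

ltBy-greatest⇒< : ∀ (τ : ℕ → ℕ) {lo hi m} → IsGreatest (ltBy τ) lo hi m →
  ∀ x → lo ≤ x → x ≤ hi → x ≢ m → τ x < τ m
ltBy-greatest⇒< τ (_ , _ , greatest) x lo≤x x≤hi x≢m with greatest x lo≤x x≤hi
... | inj₁ x≡m = ⊥-elim (x≢m x≡m)
... | inj₂ τx<τm = <ᵇ≡true⇒< τx<τm

IsLinearExtension : (ℕ → ℕ) → (ℕ → ℕ → Bool) → Set
IsLinearExtension τ lt = ∀ {x y} → lt x y ≡ true → τ x < τ y

ltBy-asym : ∀ τ {x y} → ltBy τ x y ≡ true → ltBy τ y x ≡ true → ⊥
ltBy-asym τ {x} {y} x≺y y≺x = <-asym (<ᵇ≡true⇒< {τ x} x≺y) (<ᵇ≡true⇒< {τ y} y≺x)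

IsLinearExtension⇒asym : ∀ {τ lt} → IsLinearExtension τ lt → ∀ {x y} → lt x y ≡ true → lt y x ≡ true → ⊥
IsLinearExtension⇒asym ext x≺y y≺x = <-asym (ext x≺y) (ext y≺x)

IsLinearExtension⇒⊆ltBy : ∀ {τ lt} → IsLinearExtension τ lt → ∀ {x y} → lt x y ≡ true → ltBy τ x y ≡ true
IsLinearExtension⇒⊆ltBy ext = <⇒<ᵇ≡true ∘ ext

addCover-⊇ : ∀ (lt : ℕ → ℕ → Bool) a b {x y} → lt x y ≡ true → addCover lt a b x y ≡ true
addCover-⊇ lt a b = ∨-trueˡ _

addCover-new : ∀ (lt : ℕ → ℕ → Bool) a b {x} → x ≡ a ⊎ lt x a ≡ true → addCover lt a b x b ≡ true
addCover-new lt a b {x} x≼a = ∨-trueʳ (lt x b) (∧-true⁺ (≼a x≼a) (∨-trueʳ (lt b b) (≡⇒≡ᵇ≡true {b} refl)))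
  where
  ≼a : x ≡ a ⊎ lt x a ≡ true → (lt x a ∨ (x ≡ᵇ a)) ≡ true
  ≼a (inj₁ x≡a) = ∨-trueʳ (lt x a) (≡⇒≡ᵇ≡true x≡a)
  ≼a (inj₂ x≺a) = ∨-trueˡ _ x≺a

addCover-linearExtension : ∀ {τ lt} → IsLinearExtension τ lt → ∀ {a b} → τ a < τ b →
  IsLinearExtension τ (addCover lt a b)
addCover-linearExtension {τ} {lt} ext {a} {b} τa<τb {x} {y} x≺y with ∨-true⁻ (lt x y) _ x≺y
... | inj₁ old = ext old
... | inj₂ new with ∧-true⁻ _ _ new
... | x≼a , b≼y = ≤-<-trans (≼⇒≤ (∨-true⁻ _ _ x≼a)) (<-≤-trans τa<τb (≼⇒≤ (∨-true⁻ _ _ b≼y)))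
  where
  ≼⇒≤ : ∀ {u v} → lt u v ≡ true ⊎ (u ≡ᵇ v) ≡ true → τ u ≤ τ v
  ≼⇒≤ (inj₁ u≺v) = <⇒≤ (ext u≺v)
  ≼⇒≤ (inj₂ u≡v) = ≤-reflexive (cong τ (≡ᵇ≡true⇒≡ u≡v))

addCover-greatestʳ : ∀ (lt : ℕ → ℕ → Bool) {lo m hi a b} →
  IsGreatest lt lo m a → IsGreatest lt (suc m) hi b → IsGreatest (addCover lt a b) lo hi b
addCover-greatestʳ lt {lo} {m} {hi} {a} {b} (lo≤a , a≤m , a-greatest) (m<b , b≤hi , b-greatest) =
  ≤-trans (≤-trans lo≤a a≤m) (<⇒≤ m<b) , b≤hi , below-b
  where
  below-b : ∀ y → lo ≤ y → y ≤ hi → y ≡ b ⊎ addCover lt a b y b ≡ true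
  below-b y lo≤y y≤hi with y ≤? m
  ... | yes y≤m = inj₂ (addCover-new lt a b (a-greatest y lo≤y y≤m))
  ... | no y≰m = Sum.map₂ (addCover-⊇ lt a b) (b-greatest y (≰⇒> y≰m) y≤hi)

addCover-greatestˡ : ∀ (lt : ℕ → ℕ → Bool) {lo m hi a b} →
  IsGreatest lt lo m a → IsGreatest lt (suc m) hi b → IsGreatest (addCover lt b a) lo hi a
addCover-greatestˡ lt {lo} {m} {hi} {a} {b} (lo≤a , a≤m , a-greatest) (m<b , b≤hi , b-greatest) =
  lo≤a , ≤-trans (≤-trans a≤m (<⇒≤ m<b)) b≤hi , below-a
  where
  below-a : ∀ y → lo ≤ y → y ≤ hi → y ≡ a ⊎ addCover lt b a y a ≡ true
  below-a y lo≤y y≤hi with y ≤? m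
  ... | yes y≤m = Sum.map₂ (addCover-⊇ lt b a) (a-greatest y lo≤y y≤m)
  ... | no y≰m = inj₂ (addCover-new lt b a (b-greatest y (≰⇒> y≰m) y≤hi))

-- Blocks of positions and their minima

Connected : (ℕ → Bool) → ℕ → ℕ → Set
Connected rem x y = ∀ j → x ≤ j → j < y → rem j ≡ true

connected-refl : ∀ rem x → Connected rem x x
connected-refl rem x j x≤j j<x = ⊥-elim (<⇒≱ j<x x≤j)

connected-⊆ : ∀ {rem x y x′ y′} → x ≤ x′ → y′ ≤ y → Connected rem x y → Connected rem x′ y′
connected-⊆ x≤x′ y′≤y conn j x′≤j j<y′ = conn j (≤-trans x≤x′ x′≤j) (<-≤-trans j<y′ y′≤y)

connected-trans : ∀ {rem x y z} → Connected rem x y → Connected rem y z → Connected rem x z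
connected-trans {y = y} conn₁ conn₂ j x≤j j<z with j <? y
... | yes j<y = conn₁ j x≤j j<y
... | no j≮y = conn₂ j (≮⇒≥ j≮y) j<z

connected-snoc : ∀ {rem x y} → Connected rem x y → rem y ≡ true → Connected rem x (suc y)
connected-snoc conn rem-y j x≤j j<sy with m≤n⇒m<n∨m≡n (≤-pred j<sy)
... | inj₁ j<y = conn j x≤j j<y
... | inj₂ refl = rem-y

connected-cons : ∀ {rem x y} → rem x ≡ true → Connected rem (suc x) y → Connected rem x y
connected-cons rem-x conn j x≤j j<y with m≤n⇒m<n∨m≡n x≤j
... | inj₁ x<j = conn j x<j j<y
... | inj₂ refl = rem-x

module BlockMinima (w : ℕ → ℕ) (rem : ℕ → Bool) where

  leftMin≤ : ∀ p y → 1 ≤ y → y ≤ p → Connected rem y p → leftMin w rem p ≤ w y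
  leftMin≤ zero y 1≤y y≤0 _ with () ← ≤-trans 1≤y y≤0
  leftMin≤ (suc zero) y 1≤y y≤1 _ rewrite ≤-antisym y≤1 1≤y = ≤-refl
  leftMin≤ (suc (suc p)) y 1≤y y≤p conn with m≤n⇒m<n∨m≡n y≤p | leftMin≤ (suc p) y 1≤y
  ... | inj₁ y<p | ih = subst (_≤ w y) (sym (if-true _ _ (conn (suc p) (≤-pred y<p) ≤-refl)))
    (≤-trans (m⊓n≤n _ _) (ih (≤-pred y<p) (connected-⊆ ≤-refl (n≤1+n _) conn)))
  ... | inj₂ refl | _ with rem (suc p)
  ...   | true = m⊓n≤m _ _
  ...   | false = ≤-refl

  leftMin-attained : ∀ p → 1 ≤ p → ∃ λ x → 1 ≤ x × x ≤ p × Connected rem x p × leftMin w rem p ≡ w x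
  leftMin-attained (suc zero) _ = 1 , ≤-refl , ≤-refl , connected-refl rem 1 , refl
  leftMin-attained (suc (suc p)) _ with leftMin-attained (suc p) (s≤s z≤n) | rem (suc p) in rem-p
  ... | _ | false = suc (suc p) , s≤s z≤n , ≤-refl , connected-refl rem _ , refl
  ... | x , 1≤x , x≤p , conn , min≡wx | true with ⊓-sel (w (suc (suc p))) (leftMin w rem (suc p))
  ...   | inj₁ min≡here = suc (suc p) , s≤s z≤n , ≤-refl , connected-refl rem _ , min≡here
  ...   | inj₂ min≡rest = x , 1≤x , m≤n⇒m≤1+n x≤p , connected-snoc conn rem-p , trans min≡rest min≡wx

  rightMin≤ : ∀ m p y → p ≤ y → y ≤ p + m → Connected rem p y → rightMin w rem m p ≤ w y
  rightMin≤ zero p y p≤y y≤p _ rewrite ≤-antisym y≤p (subst (_≤ y) (sym (+-identityʳ p)) p≤y) | +-identityʳ p = ≤-refl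
  rightMin≤ (suc m) p y p≤y y≤p+m conn with m≤n⇒m<n∨m≡n p≤y
  ... | inj₁ p<y rewrite conn p ≤-refl p<y =
    ≤-trans (m⊓n≤n _ _) (rightMin≤ m (suc p) y p<y (subst (y ≤_) (+-suc p m) y≤p+m) (connected-⊆ (n≤1+n p) ≤-refl conn))
  ... | inj₂ refl with rem p
  ...   | true = m⊓n≤m _ _
  ...   | false = ≤-refl

  rightMin-attained : ∀ m p → ∃ λ x → p ≤ x × x ≤ p + m × Connected rem p x × rightMin w rem m p ≡ w x
  rightMin-attained zero p = p , ≤-refl , m≤m+n p 0 , connected-refl rem p , refl
  rightMin-attained (suc m) p with rem p in rem-p
  ... | false = p , ≤-refl , m≤m+n p _ , connected-refl rem p , refl
  ... | true with rightMin-attained m (suc p) | ⊓-sel (w p) (rightMin w rem m (suc p))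
  ...   | _ | inj₁ min≡here = p , ≤-refl , m≤m+n p _ , connected-refl rem p , min≡here
  ...   | x , p<x , x≤ , conn , min≡wx | inj₂ min≡rest =
    x , <⇒≤ p<x , subst (x ≤_) (sym (+-suc p m)) x≤ , connected-cons rem-p conn , trans min≡rest min≡wx

neg≢pos : ∀ a {v} → 1 ≤ v → - (+ a) ≢ + v
neg≢pos zero {suc v} _ ()
neg≢pos (suc a) {suc v} _ ()

mergeLabel : ℕ → ℕ → ℤ
mergeLabel m m′ = if m <ᵇ m′ then + m′ else - (+ m)

mergeLabel-< : ∀ {m m′} → m < m′ → mergeLabel m m′ ≡ + m′
mergeLabel-< m<m′ = if-true _ _ (<⇒<ᵇ≡true m<m′)

mergeLabel-≥ : ∀ {m m′} → m′ ≤ m → mergeLabel m m′ ≡ - (+ m)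
mergeLabel-≥ m′≤m = if-false _ _ (≤⇒<ᵇ≡false m′≤m)

mergeLabel≡+⁻ : ∀ {m m′ v} → 1 ≤ v → mergeLabel m m′ ≡ + v → m < m′ × m′ ≡ v
mergeLabel≡+⁻ {m} {m′} 1≤v eq with m <ᵇ m′ in m<ᵇm′
... | true = <ᵇ≡true⇒< m<ᵇm′ , ℤ.+-injective eq
... | false = ⊥-elim (neg≢pos m 1≤v eq)

pick : {A : Set} → Bool → Bool → Bool → A → A → A
pick L R y x x′ = if L then x′ else if R then x else if y then x else x′

∣pick-±∣ : ∀ L R y v → ℤ.∣ pick L R y (+ v) (- (+ v)) ∣ ≡ v
∣pick-±∣ true R y v = ℤ.∣-i∣≡∣i∣ (+ v)
∣pick-±∣ false true y v = refl
∣pick-±∣ false false true v = refl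
∣pick-±∣ false false false v = ℤ.∣-i∣≡∣i∣ (+ v)

-- Removing the bars of w in the order σ

-- w, σ and τ = σ⁻¹ in one-line notation on ℕ: positions 1..n+1, bars and steps 1..n, where
-- bar j separates positions j and j+1.
module Removals (n : ℕ) (w σ τ : ℕ → ℕ)
  (w-range : ∀ p → 1 ≤ p → p ≤ suc n → 1 ≤ w p × w p ≤ suc n)
  (w-injective : ∀ {p q} → 1 ≤ p → p ≤ suc n → 1 ≤ q → q ≤ suc n → w p ≡ w q → p ≡ q)
  (w-surjective : ∀ v → 1 ≤ v → v ≤ suc n → ∃ λ p → 1 ≤ p × p ≤ suc n × w p ≡ v)
  (σ-range : ∀ k → 1 ≤ k → k ≤ n → 1 ≤ σ k × σ k ≤ n)
  (τ-range : ∀ x → 1 ≤ x → x ≤ n → 1 ≤ τ x × τ x ≤ n)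
  (σ∘τ : ∀ x → 1 ≤ x → x ≤ n → σ (τ x) ≡ x)
  (τ∘σ : ∀ k → 1 ≤ k → k ≤ n → τ (σ k) ≡ k)
  where

  τ-injective : ∀ {x y} → 1 ≤ x → x ≤ n → 1 ≤ y → y ≤ n → τ x ≡ τ y → x ≡ y
  τ-injective {x} {y} 1≤x x≤n 1≤y y≤n τx≡τy = begin
    x         ≡⟨ σ∘τ x 1≤x x≤n ⟨
    σ (τ x)   ≡⟨ cong σ τx≡τy ⟩
    σ (τ y)   ≡⟨ σ∘τ y 1≤y y≤n ⟩
    y         ∎
    where open ≡-Reasoning

  Removed : ℕ → ℕ → Set
  Removed k j = removedBefore σ k j ≡ true

  SameBlock : ℕ → ℕ → ℕ → Set
  SameBlock k = Connected (removedBefore σ k)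

  removed⁻ : ∀ {k j} → k ≤ suc n → Removed k j → 1 ≤ j × j ≤ n × τ j < k
  removed⁻ {suc k} {j} k≤ rem with any-range⁻ _ 1 k rem
  ... | k′ , 1≤k′ , k′≤k , σk′≡ᵇj with ≡ᵇ≡true⇒≡ {σ k′} {j} σk′≡ᵇj
  ... | refl = proj₁ (σ-range k′ 1≤k′ k′≤n) , proj₂ (σ-range k′ 1≤k′ k′≤n) ,
               subst (_< suc k) (sym (τ∘σ k′ 1≤k′ k′≤n)) (s≤s k′≤k)
    where
    k′≤n : k′ ≤ n
    k′≤n = ≤-trans k′≤k (≤-pred k≤)

  removed⁺ : ∀ {k j} → 1 ≤ j → j ≤ n → τ j < k → Removed k j
  removed⁺ {suc k} {j} 1≤j j≤n τj<k =
    any-range⁺ _ (proj₁ (τ-range j 1≤j j≤n)) (≤-pred τj<k) (≡⇒≡ᵇ≡true (σ∘τ j 1≤j j≤n))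

  removed⇒earlier : ∀ {x j} → 1 ≤ x → x ≤ n → Removed (τ x) j → τ j < τ x
  removed⇒earlier 1≤x x≤n rem = proj₂ (proj₂ (removed⁻ (m≤n⇒m≤1+n (proj₂ (τ-range _ 1≤x x≤n))) rem))

  block-end≤ : ∀ {k p x} → k ≤ suc n → p ≤ suc n → SameBlock k p x → x ≤ suc n
  block-end≤ {k} {p} {x} k≤ p≤ conn with x ≤? suc n
  ... | yes x≤ = x≤
  ... | no x≰ = ⊥-elim (<-irrefl refl (proj₁ (proj₂ (removed⁻ k≤ (conn (suc n) p≤ (≰⇒> x≰))))))

  minLeft : ℕ → ℕ → ℕ
  minLeft k j = leftMin w (removedBefore σ k) j

  minRight : ℕ → ℕ → ℕ
  minRight k j = rightMin w (removedBefore σ k) n (suc j)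

  lamN-at : ∀ {j} → 1 ≤ j → j ≤ n → lamN n w σ (τ j) ≡ mergeLabel (minLeft (τ j) j) (minRight (τ j) j)
  lamN-at {j} 1≤j j≤n = cong (λ x → mergeLabel (minLeft (τ j) x) (minRight (τ j) x)) (σ∘τ j 1≤j j≤n)

  ino⁻ : ∀ {v} → inIno n w σ v ≡ true → ∃ λ k → 1 ≤ k × k ≤ n × lamN n w σ k ≡ + v
  ino⁻ {v} v∈Y with any-range⁻ _ 1 n (proj₁ (∧-true⁻ _ _ v∈Y))
  ... | k , 1≤k , k≤n , found = k , 1≤k , k≤n , does-true⁻ (lamN n w σ k ℤ.≟ + v) found

  ino⁺ : ∀ {v k} → 1 ≤ v → 1 ≤ k → k ≤ n → lamN n w σ k ≡ + v → inIno n w σ v ≡ true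
  ino⁺ {v} 1≤v 1≤k k≤n λk≡v =
    ∧-true⁺ (any-range⁺ (λ k → does (lamN n w σ k ℤ.≟ + v)) 1≤k k≤n (does-true⁺ (lamN n w σ _ ℤ.≟ + v) λk≡v))
            (<⇒<ᵇ≡true 1≤v)

  NearestSmallerLeft : ℕ → ℕ → ℕ → Set
  NearestSmallerLeft v i ℓ = 1 ≤ ℓ × ℓ < i × w ℓ < v × (∀ j → ℓ < j → j < i → v < w j)

  NearestSmallerRight : ℕ → ℕ → ℕ → Set
  NearestSmallerRight v i r = i < r × r ≤ suc n × w r < v × (∀ j → i < j → j < r → v < w j)

  RemovedLastIn : ℕ → ℕ → ℕ → Set
  RemovedLastIn lo hi a = lo ≤ a × a < hi × (∀ x → lo ≤ x → x < hi → x ≢ a → τ x < τ a)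

  BlockAboveˡ : ℕ → ℕ → ℕ → Set
  BlockAboveˡ k v i = ∀ x → 1 ≤ x → x < i → SameBlock k x i → v < w x

  BlockAboveʳ : ℕ → ℕ → ℕ → Set
  BlockAboveʳ k v i = ∀ x → i < x → x ≤ suc n → SameBlock k i x → v < w x

  RemovedLastIn-range : ∀ {lo hi a} → 1 ≤ lo → hi ≤ suc n → RemovedLastIn lo hi a → 1 ≤ a × a ≤ n
  RemovedLastIn-range 1≤lo hi≤ (lo≤a , a<hi , _) = ≤-trans 1≤lo lo≤a , ≤-pred (≤-trans a<hi hi≤)

  RemovedLastIn-blocks : ∀ {lo hi a} → 1 ≤ lo → hi ≤ suc n → RemovedLastIn lo hi a →
    SameBlock (τ a) lo a × SameBlock (τ a) (suc a) hi
  RemovedLastIn-blocks {lo} {hi} {a} 1≤lo hi≤ (lo≤a , a<hi , latest) = left , right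
    where
    removed : ∀ j → lo ≤ j → j < hi → j ≢ a → Removed (τ a) j
    removed j lo≤j j<hi j≢a = removed⁺ (≤-trans 1≤lo lo≤j) (≤-pred (≤-trans j<hi hi≤)) (latest j lo≤j j<hi j≢a)
    left : SameBlock (τ a) lo a
    left j lo≤j j<a = removed j lo≤j (<-trans j<a a<hi) (<⇒≢ j<a)
    right : SameBlock (τ a) (suc a) hi
    right j a<j j<hi = removed j (≤-trans lo≤a (<⇒≤ a<j)) j<hi (≢-sym (<⇒≢ a<j))

  lamN-lastRemovedˡ : ∀ {v i ℓ a} → i ≤ suc n → w i ≡ v → NearestSmallerLeft v i ℓ → RemovedLastIn ℓ i a →
    BlockAboveʳ (τ a) v i → lamN n w σ (τ a) ≡ + v
  lamN-lastRemovedˡ {v} {i} {ℓ} {a} i≤ wi≡v (1≤ℓ , ℓ<i , wℓ<v , above) last@(ℓ≤a , a<i , _) aboveʳ = begin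
    lamN n w σ (τ a)                               ≡⟨ lamN-at 1≤a a≤n ⟩
    mergeLabel (minLeft (τ a) a) (minRight (τ a) a) ≡⟨ mergeLabel-< (<-≤-trans minB<v v≤minB′) ⟩
    + minRight (τ a) a                             ≡⟨ cong +_ (≤-antisym minB′≤v v≤minB′) ⟩
    + v                                            ∎
    where
    open ≡-Reasoning
    open BlockMinima w (removedBefore σ (τ a))
    1≤a : 1 ≤ a
    1≤a = proj₁ (RemovedLastIn-range 1≤ℓ i≤ last)
    a≤n : a ≤ n
    a≤n = proj₂ (RemovedLastIn-range 1≤ℓ i≤ last)
    blocks : SameBlock (τ a) ℓ a × SameBlock (τ a) (suc a) i
    blocks = RemovedLastIn-blocks 1≤ℓ i≤ last
    minB<v : minLeft (τ a) a < v
    minB<v = ≤-<-trans (leftMin≤ a ℓ 1≤ℓ ℓ≤a (proj₁ blocks)) wℓ<v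
    minB′≤v : minRight (τ a) a ≤ v
    minB′≤v = subst (minRight (τ a) a ≤_) wi≡v (rightMin≤ n (suc a) i a<i (≤-trans i≤ (s≤s (m≤n+m n a))) (proj₂ blocks))
    v≤minB′ : v ≤ minRight (τ a) a
    v≤minB′ with rightMin-attained n (suc a)
    ... | x , a<x , _ , conn , minB′≡wx = subst (v ≤_) (sym minB′≡wx) v≤wx
      where
      v≤wx : v ≤ w x
      v≤wx with <-cmp x i
      ... | tri< x<i _ _ = <⇒≤ (above x (≤-<-trans ℓ≤a a<x) x<i)
      ... | tri≈ _ refl _ = ≤-reflexive (sym wi≡v)
      ... | tri> _ _ i<x = <⇒≤ (aboveʳ x i<x (block-end≤ (m≤n⇒m≤1+n (proj₂ (τ-range a 1≤a a≤n))) (s≤s a≤n) conn)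
                                               (connected-⊆ a<i ≤-refl conn))

  lamN-lastRemovedʳ : ∀ {v i r b} → 1 ≤ i → w i ≡ v → NearestSmallerRight v i r → RemovedLastIn i r b →
    BlockAboveˡ (τ b) v i → lamN n w σ (τ b) ≡ - (+ v)
  lamN-lastRemovedʳ {v} {i} {r} {b} 1≤i wi≡v (i<r , r≤ , wr<v , above) last@(i≤b , b<r , _) aboveˡ = begin
    lamN n w σ (τ b)                               ≡⟨ lamN-at 1≤b b≤n ⟩
    mergeLabel (minLeft (τ b) b) (minRight (τ b) b) ≡⟨ mergeLabel-≥ (<⇒≤ (<-≤-trans minB′<v v≤minB)) ⟩
    - (+ minLeft (τ b) b)                          ≡⟨ cong (λ m → - (+ m)) (≤-antisym minB≤v v≤minB) ⟩
    - (+ v)                                        ∎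
    where
    open ≡-Reasoning
    open BlockMinima w (removedBefore σ (τ b))
    1≤b : 1 ≤ b
    1≤b = proj₁ (RemovedLastIn-range 1≤i r≤ last)
    b≤n : b ≤ n
    b≤n = proj₂ (RemovedLastIn-range 1≤i r≤ last)
    blocks : SameBlock (τ b) i b × SameBlock (τ b) (suc b) r
    blocks = RemovedLastIn-blocks 1≤i r≤ last
    minB′<v : minRight (τ b) b < v
    minB′<v = ≤-<-trans (rightMin≤ n (suc b) r b<r (≤-trans r≤ (s≤s (m≤n+m n b))) (proj₂ blocks)) wr<v
    minB≤v : minLeft (τ b) b ≤ v
    minB≤v = subst (minLeft (τ b) b ≤_) wi≡v (leftMin≤ b i 1≤i i≤b (proj₁ blocks))
    v≤minB : v ≤ minLeft (τ b) b
    v≤minB with leftMin-attained b 1≤b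
    ... | x , 1≤x , x≤b , conn , minB≡wx = subst (v ≤_) (sym minB≡wx) v≤wx
      where
      v≤wx : v ≤ w x
      v≤wx with <-cmp x i
      ... | tri< x<i _ _ = <⇒≤ (aboveˡ x 1≤x x<i (connected-⊆ ≤-refl i≤b conn))
      ... | tri≈ _ refl _ = ≤-reflexive (sym wi≡v)
      ... | tri> _ _ i<x = <⇒≤ (above x i<x (≤-<-trans x≤b b<r))

  -- If λ_k = +v, the block right of bar σ k has minimum v, so it reaches i but not r.  This also
  -- forces τ a ≤ k, so τ b < τ a would remove every bar in [i, r) before step k.
  lamN≡+⇒¬right-first : ∀ {v i ℓ r k a b} → 1 ≤ v → w i ≡ v →
    NearestSmallerLeft v i ℓ → NearestSmallerRight v i r → 1 ≤ k → k ≤ n → lamN n w σ k ≡ + v →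
    ℓ ≤ a → a < i → RemovedLastIn i r b → ¬ τ b < τ a
  lamN≡+⇒¬right-first {v} {i} {ℓ} {r} {k} {a} {b} 1≤v wi≡v (1≤ℓ , ℓ<i , _ , aboveˡ) (i<r , r≤ , wr<v , _)
    1≤k k≤n λk≡v ℓ≤a a<i (_ , _ , last) τb<τa =
    <-irrefl (proj₂ positive) (≤-<-trans minB′≤wr wr<v)
    where
    open BlockMinima w (removedBefore σ k)
    1≤σk : 1 ≤ σ k
    1≤σk = proj₁ (σ-range k 1≤k k≤n)
    σk≤n : σ k ≤ n
    σk≤n = proj₂ (σ-range k 1≤k k≤n)
    k≤ : k ≤ suc n
    k≤ = m≤n⇒m≤1+n k≤n
    1≤i : 1 ≤ i
    1≤i = ≤-trans 1≤ℓ (<⇒≤ ℓ<i)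
    positive : minLeft k (σ k) < minRight k (σ k) × minRight k (σ k) ≡ v
    positive = mergeLabel≡+⁻ 1≤v λk≡v
    reaches-i : σ k < i × SameBlock k (suc (σ k)) i
    reaches-i with rightMin-attained n (suc (σ k))
    ... | x , σk<x , _ , conn , minB′≡wx
      with w-injective (≤-trans (s≤s z≤n) σk<x) (block-end≤ k≤ (s≤s σk≤n) conn) 1≤i (≤-trans (<⇒≤ i<r) r≤)
                       (trans (sym minB′≡wx) (trans (proj₂ positive) (sym wi≡v)))
    ... | refl = σk<x , conn
    τa≤k : τ a ≤ k
    τa≤k with <-cmp a (σ k)
    ... | tri≈ _ refl _ = ≤-reflexive (τ∘σ k 1≤k k≤n)
    ... | tri> _ _ σk<a = <⇒≤ (proj₂ (proj₂ (removed⁻ k≤ (proj₂ reaches-i a σk<a a<i))))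
    ... | tri< a<σk _ _ with leftMin-attained (σ k) 1≤σk
    ...   | x , 1≤x , x≤σk , conn , minB≡wx with x ≤? ℓ
    ...     | yes x≤ℓ = <⇒≤ (proj₂ (proj₂ (removed⁻ k≤ (conn a (≤-trans x≤ℓ ℓ≤a) a<σk))))
    ...     | no x≰ℓ = ⊥-elim (<-asym (aboveˡ x (≰⇒> x≰ℓ) (≤-<-trans x≤σk (proj₁ reaches-i)))
                                      (subst₂ _<_ minB≡wx (proj₂ positive) (proj₁ positive)))
    reaches-r : SameBlock k i r
    reaches-r t i≤t t<r = removed⁺ (≤-trans 1≤i i≤t) (≤-pred (≤-trans t<r r≤)) (<-≤-trans τt<τa τa≤k)
      where
      τt<τa : τ t < τ a
      τt<τa with t ≟ b
      ... | yes refl = τb<τa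
      ... | no t≢b = <-trans (last t i≤t t<r t≢b) τb<τa
    minB′≤wr : minRight k (σ k) ≤ w r
    minB′≤wr = rightMin≤ n (suc (σ k)) r (<-trans (proj₁ reaches-i) i<r) (≤-trans r≤ (s≤s (m≤n+m n (σ k))))
                 (connected-trans (proj₂ reaches-i) reaches-r)

  position : ℕ → ℕ
  position v = firstSat (λ j → w j ≡ᵇ v) (range 1 (suc n)) 0

  isLRmin : ℕ → Bool
  isLRmin v = not (any (λ j → w j <ᵇ v) (range 1 (position v ∸ 1)))

  isRLmin : ℕ → Bool
  isRLmin v = not (any (λ j → w j <ᵇ v) (range (suc (position v)) (suc n)))

  nearestLeft : ℕ → ℕ
  nearestLeft v = firstSat (λ j → w j <ᵇ v) (reverse (range 1 (position v ∸ 1))) 0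

  nearestRight : ℕ → ℕ
  nearestRight v = firstSat (λ j → w j <ᵇ v) (range (suc (position v)) (suc n)) 0

  Y : ℕ → Bool
  Y = inIno n w σ

  lastRemovedˡ : ℕ → ℕ
  lastRemovedˡ v = maxElem (ltBy τ) (nearestLeft v) (position v ∸ 1)

  lastRemovedʳ : ℕ → ℕ
  lastRemovedʳ v = maxElem (ltBy τ) (position v) (nearestRight v ∸ 1)

  -- c(v) and its label, with the maxima taken for the removal order τ instead of for P; the
  -- invariant of the construction shows that the two agree.
  labelledBar : ℕ → ℕ
  labelledBar v = pick (isLRmin v) (isRLmin v) (Y v) (lastRemovedˡ v) (lastRemovedʳ v)

  label : ℕ → ℤ
  label v = pick (isLRmin v) (isRLmin v) (Y v) (+ v) (- (+ v))

  RemovalLabel : ℕ → ℤ → Set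
  RemovalLabel c z = 1 ≤ c × c ≤ n × lamN n w σ (τ c) ≡ z

  -- Positions lo and hi+1 carry values ≤ s and all positions between them values > s.  The
  -- sets {ℓ, …, i−1} and {i, …, r−1} whose maxima the construction uses are such runs of bars.
  Run : ℕ → ℕ → ℕ → Set
  Run s lo hi = 1 ≤ lo × lo ≤ hi × hi ≤ n × w lo ≤ s × w (suc hi) ≤ s × (∀ j → lo < j → j ≤ hi → s < w j)

  NearestSmallerLeft⇒Run : ∀ {v i ℓ} → 1 ≤ i → i ≤ suc n → w i ≡ v → NearestSmallerLeft v i ℓ → Run v ℓ (pred i)
  NearestSmallerLeft⇒Run {v} {i} 1≤i i≤ wi≡v (1≤ℓ , ℓ<i , wℓ<v , between) =
    1≤ℓ , <⇒≤pred ℓ<i , pred-mono-≤ i≤ , <⇒≤ wℓ<v ,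
    subst (λ p → w p ≤ v) (sym i≡) (≤-reflexive wi≡v) , λ j ℓ<j j≤ → between j ℓ<j (≤pred⇒< 1≤i j≤)
    where
    i≡ : suc (pred i) ≡ i
    i≡ = suc-pred′ 1≤i

  NearestSmallerRight⇒Run : ∀ {v i r} → 1 ≤ i → w i ≡ v → NearestSmallerRight v i r → Run v i (pred r)
  NearestSmallerRight⇒Run {v} {i} {r} 1≤i wi≡v (i<r , r≤ , wr<v , between) =
    1≤i , <⇒≤pred i<r , pred-mono-≤ r≤ , ≤-reflexive wi≡v ,
    subst (λ p → w p ≤ v) (sym r≡) (<⇒≤ wr<v) , λ j i<j j≤ → between j i<j (≤pred⇒< 1≤r j≤)
    where
    1≤r : 1 ≤ r
    1≤r = ≤-trans (s≤s z≤n) i<r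
    r≡ : suc (pred r) ≡ r
    r≡ = suc-pred′ 1≤r

  NearestSmallerLeft-in-run : ∀ {s i ℓ lo hi} → Run s lo hi → lo < i → i ≤ hi → NearestSmallerLeft (suc s) i ℓ → ℓ ≡ lo
  NearestSmallerLeft-in-run {ℓ = ℓ} {lo} (_ , _ , _ , wlo≤s , _ , between) lo<i i≤hi (_ , ℓ<i , wℓ≤s , between′)
    with <-cmp ℓ lo
  ... | tri≈ _ ℓ≡lo _ = ℓ≡lo
  ... | tri< ℓ<lo _ _ = ⊥-elim (<⇒≱ (between′ lo ℓ<lo lo<i) (m≤n⇒m≤1+n wlo≤s))
  ... | tri> _ _ lo<ℓ = ⊥-elim (<⇒≱ wℓ≤s (between ℓ lo<ℓ (≤-trans (<⇒≤ ℓ<i) i≤hi)))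

  NearestSmallerRight-in-run : ∀ {s i r lo hi} → Run s lo hi → lo < i → i ≤ hi → NearestSmallerRight (suc s) i r → r ≡ suc hi
  NearestSmallerRight-in-run {r = r} {hi = hi} (_ , _ , _ , _ , whi≤s , between) lo<i i≤hi (i<r , _ , wr≤s , between′)
    with <-cmp r (suc hi)
  ... | tri≈ _ r≡hi _ = r≡hi
  ... | tri< r<hi _ _ = ⊥-elim (<⇒≱ wr≤s (between r (<-trans lo<i i<r) (≤-pred r<hi)))
  ... | tri> _ _ hi<r = ⊥-elim (<⇒≱ (between′ (suc hi) (s≤s i≤hi) hi<r) (m≤n⇒m≤1+n whi≤s))

  module Value (v : ℕ) (2≤v : 2 ≤ v) (v≤ : v ≤ suc n) where

    1≤v : 1 ≤ v
    1≤v = ≤-trans (s≤s z≤n) 2≤v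

    position-spec : 1 ≤ position v × position v ≤ suc n × w (position v) ≡ v
    position-spec with w-surjective v 1≤v v≤
    ... | p , 1≤p , p≤ , wp≡v with firstSat-range (λ j → w j ≡ᵇ v) 0 1≤p p≤ (≡⇒≡ᵇ≡true wp≡v)
    ...   | 1≤i , i≤ , wi≡ᵇv , _ = 1≤i , i≤ , ≡ᵇ≡true⇒≡ wi≡ᵇv

    i ℓ r a b : ℕ
    i = position v
    ℓ = nearestLeft v
    r = nearestRight v
    a = lastRemovedˡ v
    b = lastRemovedʳ v

    1≤i : 1 ≤ i
    1≤i = proj₁ position-spec

    i≤ : i ≤ suc n
    i≤ = proj₁ (proj₂ position-spec)

    wi≡v : w i ≡ v
    wi≡v = proj₂ (proj₂ position-spec)

    above : ∀ {j} → 1 ≤ j → j ≤ suc n → j ≢ i → (w j <ᵇ v) ≡ false → v < w j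
    above 1≤j j≤ j≢i wj≮v = ≤∧≢⇒< (<ᵇ≡false⇒≥ wj≮v) λ v≡wj → j≢i (w-injective 1≤j j≤ 1≤i i≤ (trans (sym v≡wj) (sym wi≡v)))

    nearestLeft-spec : isLRmin v ≡ false → NearestSmallerLeft v i ℓ
    nearestLeft-spec notLR with any-range⁻ _ 1 (pred i) (not≡false⇒≡true notLR)
    ... | x , 1≤x , x≤ , wx<v with firstSat-reverse-range (λ j → w j <ᵇ v) 0 1≤x x≤ wx<v
    ...   | 1≤ℓ , ℓ≤ , wℓ<v , after = 1≤ℓ , ≤pred⇒< 1≤i ℓ≤ , <ᵇ≡true⇒< wℓ<v , λ j ℓ<j j<i →
      above (≤-trans 1≤ℓ (<⇒≤ ℓ<j)) (≤-trans (<⇒≤ j<i) i≤) (<⇒≢ j<i) (after j ℓ<j (<⇒≤pred j<i))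

    LRmin-above : isLRmin v ≡ true → ∀ j → 1 ≤ j → j < i → v < w j
    LRmin-above LR j 1≤j j<i = above 1≤j (≤-trans (<⇒≤ j<i) i≤) (<⇒≢ j<i)
      (any-range-false _ 1 (pred i) (not≡true⇒≡false LR) j 1≤j (<⇒≤pred j<i))

    nearestRight-spec : isRLmin v ≡ false → NearestSmallerRight v i r
    nearestRight-spec notRL with any-range⁻ _ (suc i) (suc n) (not≡false⇒≡true notRL)
    ... | x , i<x , x≤ , wx<v with firstSat-range (λ j → w j <ᵇ v) 0 i<x x≤ wx<v
    ...   | i<r , r≤ , wr<v , before = i<r , r≤ , <ᵇ≡true⇒< wr<v , λ j i<j j<r →
      above (≤-trans (s≤s z≤n) i<j) (≤-trans (<⇒≤ j<r) r≤) (≢-sym (<⇒≢ i<j)) (before j i<j j<r)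

    RLmin-above : isRLmin v ≡ true → ∀ j → i < j → j ≤ suc n → v < w j
    RLmin-above RL j i<j j≤ = above (≤-trans (s≤s z≤n) i<j) j≤ (≢-sym (<⇒≢ i<j))
      (any-range-false _ (suc i) (suc n) (not≡true⇒≡false RL) j i<j j≤)

    ¬LRmin×RLmin : isLRmin v ≡ true → isRLmin v ≡ true → ⊥
    ¬LRmin×RLmin LR RL with w-surjective 1 ≤-refl (s≤s z≤n)
    ... | p , 1≤p , p≤ , wp≡1 with <-cmp p i
    ... | tri< p<i _ _ = <⇒≱ (subst (v <_) wp≡1 (LRmin-above LR p 1≤p p<i)) 1≤v
    ... | tri≈ _ refl _ = <⇒≱ 2≤v (≤-reflexive (trans (sym wi≡v) wp≡1))
    ... | tri> _ _ i<p = <⇒≱ (subst (v <_) wp≡1 (RLmin-above RL p i<p p≤)) 1≤v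

    private
      maxElem-ltBy-lastRemoved : ∀ {lo hi} → 1 ≤ lo → lo < hi → hi ≤ suc n →
        RemovedLastIn lo hi (maxElem (ltBy τ) lo (pred hi))
      maxElem-ltBy-lastRemoved {lo} {hi} 1≤lo lo<hi hi≤ =
        from-greatest (ltBy-greatest τ lo (pred hi) (<⇒≤pred lo<hi) τ-injective′)
        where
        1≤hi : 1 ≤ hi
        1≤hi = ≤-trans 1≤lo (<⇒≤ lo<hi)
        τ-injective′ : ∀ {x y} → lo ≤ x → x ≤ pred hi → lo ≤ y → y ≤ pred hi → τ x ≡ τ y → x ≡ y
        τ-injective′ lo≤x x≤ lo≤y y≤ = τ-injective (≤-trans 1≤lo lo≤x) (≤-trans x≤ (pred-mono-≤ hi≤))
                                                    (≤-trans 1≤lo lo≤y) (≤-trans y≤ (pred-mono-≤ hi≤))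
        from-greatest : ∃ (IsGreatest (ltBy τ) lo (pred hi)) → RemovedLastIn lo hi (maxElem (ltBy τ) lo (pred hi))
        from-greatest (m , greatest) rewrite maxElem-greatest (ltBy τ) (ltBy-asym τ) greatest =
          proj₁ greatest , ≤pred⇒< 1≤hi (proj₁ (proj₂ greatest)) ,
          λ x lo≤x x<hi → ltBy-greatest⇒< τ greatest x lo≤x (<⇒≤pred x<hi)

    lastRemovedˡ-spec : isLRmin v ≡ false → RemovedLastIn ℓ i a
    lastRemovedˡ-spec notLR =
      maxElem-ltBy-lastRemoved (proj₁ (nearestLeft-spec notLR)) (proj₁ (proj₂ (nearestLeft-spec notLR))) i≤

    lastRemovedʳ-spec : isRLmin v ≡ false → RemovedLastIn i r b
    lastRemovedʳ-spec notRL =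
      maxElem-ltBy-lastRemoved 1≤i (proj₁ (nearestRight-spec notRL)) (proj₁ (proj₂ (nearestRight-spec notRL)))

    lastRemovedˡ-range : isLRmin v ≡ false → 1 ≤ a × a ≤ n
    lastRemovedˡ-range notLR = RemovedLastIn-range (proj₁ (nearestLeft-spec notLR)) i≤ (lastRemovedˡ-spec notLR)

    lastRemovedʳ-range : isRLmin v ≡ false → 1 ≤ b × b ≤ n
    lastRemovedʳ-range notRL = RemovedLastIn-range 1≤i (proj₁ (proj₂ (nearestRight-spec notRL))) (lastRemovedʳ-spec notRL)

    labelˡ : isLRmin v ≡ false → BlockAboveʳ (τ a) v i → RemovalLabel a (+ v)
    labelˡ notLR aboveʳ = proj₁ (lastRemovedˡ-range notLR) , proj₂ (lastRemovedˡ-range notLR) ,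
      lamN-lastRemovedˡ i≤ wi≡v (nearestLeft-spec notLR) (lastRemovedˡ-spec notLR) aboveʳ

    labelʳ : isRLmin v ≡ false → BlockAboveˡ (τ b) v i → RemovalLabel b (- (+ v))
    labelʳ notRL aboveˡ = proj₁ (lastRemovedʳ-range notRL) , proj₂ (lastRemovedʳ-range notRL) ,
      lamN-lastRemovedʳ 1≤i wi≡v (nearestRight-spec notRL) (lastRemovedʳ-spec notRL) aboveˡ

    left-first⇒aboveʳ : isLRmin v ≡ false → isRLmin v ≡ false → τ a < τ b → BlockAboveʳ (τ a) v i
    left-first⇒aboveʳ notLR notRL τa<τb x i<x x≤ conn with r ≤? x
    ... | no r≰x = proj₂ (proj₂ (proj₂ (nearestRight-spec notRL))) x i<x (≰⇒> r≰x)
    ... | yes r≤x = ⊥-elim (<-asym τa<τb (removed⇒earlier 1≤a a≤n (conn b i≤b (<-≤-trans b<r r≤x))))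
      where
      1≤a : 1 ≤ a
      1≤a = proj₁ (lastRemovedˡ-range notLR)
      a≤n : a ≤ n
      a≤n = proj₂ (lastRemovedˡ-range notLR)
      i≤b : i ≤ b
      i≤b = proj₁ (lastRemovedʳ-spec notRL)
      b<r : b < r
      b<r = proj₁ (proj₂ (lastRemovedʳ-spec notRL))

    right-first⇒aboveˡ : isLRmin v ≡ false → isRLmin v ≡ false → τ b < τ a → BlockAboveˡ (τ b) v i
    right-first⇒aboveˡ notLR notRL τb<τa x 1≤x x<i conn with x ≤? ℓ
    ... | no x≰ℓ = proj₂ (proj₂ (proj₂ (nearestLeft-spec notLR))) x (≰⇒> x≰ℓ) x<i
    ... | yes x≤ℓ = ⊥-elim (<-asym τb<τa (removed⇒earlier 1≤b b≤n (conn a (≤-trans x≤ℓ ℓ≤a) a<i)))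
      where
      1≤b : 1 ≤ b
      1≤b = proj₁ (lastRemovedʳ-range notRL)
      b≤n : b ≤ n
      b≤n = proj₂ (lastRemovedʳ-range notRL)
      ℓ≤a : ℓ ≤ a
      ℓ≤a = proj₁ (lastRemovedˡ-spec notLR)
      a<i : a < i
      a<i = proj₁ (proj₂ (lastRemovedˡ-spec notLR))

    τa≢τb : isLRmin v ≡ false → isRLmin v ≡ false → τ a ≢ τ b
    τa≢τb notLR notRL τa≡τb =
      <⇒≢ (<-≤-trans (proj₁ (proj₂ (lastRemovedˡ-spec notLR))) (proj₁ (lastRemovedʳ-spec notRL)))
          (τ-injective (proj₁ (lastRemovedˡ-range notLR)) (proj₂ (lastRemovedˡ-range notLR))
                       (proj₁ (lastRemovedʳ-range notRL)) (proj₂ (lastRemovedʳ-range notRL)) τa≡τb)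

    Y⇒left-first : isLRmin v ≡ false → isRLmin v ≡ false → Y v ≡ true → τ a < τ b
    Y⇒left-first notLR notRL v∈Y with <-cmp (τ a) (τ b)
    ... | tri< τa<τb _ _ = τa<τb
    ... | tri≈ _ τa≡τb _ = ⊥-elim (τa≢τb notLR notRL τa≡τb)
    ... | tri> _ _ τb<τa = ⊥-elim (no-positive-label (ino⁻ {v} v∈Y))
      where
      no-positive-label : (∃ λ k → 1 ≤ k × k ≤ n × lamN n w σ k ≡ + v) → ⊥
      no-positive-label (k , 1≤k , k≤n , λk≡v) =
        lamN≡+⇒¬right-first {v} {i} {ℓ} {r} {k} {a} {b} 1≤v wi≡v (nearestLeft-spec notLR) (nearestRight-spec notRL)
          1≤k k≤n λk≡v (proj₁ (lastRemovedˡ-spec notLR)) (proj₁ (proj₂ (lastRemovedˡ-spec notLR))) (lastRemovedʳ-spec notRL) τb<τa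

    ¬Y⇒right-first : isLRmin v ≡ false → isRLmin v ≡ false → Y v ≡ false → τ b < τ a
    ¬Y⇒right-first notLR notRL v∉Y with <-cmp (τ a) (τ b)
    ... | tri> _ _ τb<τa = τb<τa
    ... | tri≈ _ τa≡τb _ = ⊥-elim (τa≢τb notLR notRL τa≡τb)
    ... | tri< τa<τb _ _ = ⊥-elim (positive-label (labelˡ notLR (left-first⇒aboveʳ notLR notRL τa<τb)))
      where
      positive-label : RemovalLabel a (+ v) → ⊥
      positive-label (1≤a , a≤n , λτa≡v) =
        not-¬ (ino⁺ {v} {τ a} 1≤v (proj₁ (τ-range a 1≤a a≤n)) (proj₂ (τ-range a 1≤a a≤n)) λτa≡v) v∉Y

    labelledBar-spec : RemovalLabel (labelledBar v) (label v)
    labelledBar-spec = by-cases (isLRmin v) (isRLmin v) (Y v) refl refl refl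
      where
      by-cases : ∀ L R y → isLRmin v ≡ L → isRLmin v ≡ R → Y v ≡ y → RemovalLabel (pick L R y a b) (pick L R y (+ v) (- (+ v)))
      by-cases true true _ LR RL _ = ⊥-elim (¬LRmin×RLmin LR RL)
      by-cases true false _ LR notRL _ = labelʳ notRL λ x 1≤x x<i _ → LRmin-above LR x 1≤x x<i
      by-cases false true _ notLR RL _ = labelˡ notLR λ x i<x x≤ _ → RLmin-above RL x i<x x≤
      by-cases false false true notLR notRL v∈Y = labelˡ notLR (left-first⇒aboveʳ notLR notRL (Y⇒left-first notLR notRL v∈Y))
      by-cases false false false notLR notRL v∉Y = labelʳ notRL (right-first⇒aboveˡ notLR notRL (¬Y⇒right-first notLR notRL v∉Y))

  labelledBar-injective : ∀ {u u′} → 2 ≤ u → u ≤ suc n → 2 ≤ u′ → u′ ≤ suc n → labelledBar u ≡ labelledBar u′ → u ≡ u′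
  labelledBar-injective {u} {u′} 2≤u u≤ 2≤u′ u′≤ c≡c′ = begin
    u                   ≡⟨ ∣pick-±∣ (isLRmin u) (isRLmin u) (Y u) u ⟨
    ℤ.∣ label u ∣        ≡⟨ cong ℤ.∣_∣ (trans (sym λc≡z) (trans (cong (lamN n w σ ∘ τ) c≡c′) λc′≡z′)) ⟩
    ℤ.∣ label u′ ∣       ≡⟨ ∣pick-±∣ (isLRmin u′) (isRLmin u′) (Y u′) u′ ⟩
    u′                  ∎
    where
    open ≡-Reasoning
    λc≡z : lamN n w σ (τ (labelledBar u)) ≡ label u
    λc≡z = proj₂ (proj₂ (Value.labelledBar-spec u 2≤u u≤))
    λc′≡z′ : lamN n w σ (τ (labelledBar u′)) ≡ label u′
    λc′≡z′ = proj₂ (proj₂ (Value.labelledBar-spec u′ 2≤u′ u′≤))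

  Labelled : ℕ → (ℕ → ℤ) → Set
  Labelled s Λ = ∀ u → s < u → u ≤ suc n → Λ (labelledBar u) ≡ label u

  record Invariant (s : ℕ) (st : PState) : Set where
    field
      extension : IsLinearExtension τ (lt st)
      runs-greatest : ∀ {lo hi} → Run s lo hi → ∃ (IsGreatest (lt st) lo hi)
      labelled : Labelled s (lab st)

  module Step (s : ℕ) (1≤s : 1 ≤ s) (s≤n : s ≤ n) (st : PState) (inv : Invariant (suc s) st) where
    open Invariant inv
    open Value (suc s) (s≤s 1≤s) (s≤s s≤n)
    v am bm : ℕ
    v = suc s
    am = maxElem (lt st) ℓ (pred i)
    bm = maxElem (lt st) i (pred r)

    greatest-agrees : ∀ {lo hi} → Run (suc s) lo hi →
      IsGreatest (lt st) lo hi (maxElem (lt st) lo hi) × maxElem (lt st) lo hi ≡ maxElem (ltBy τ) lo hi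
    greatest-agrees {lo} {hi} run = agree (runs-greatest run)
      where
      agree : ∃ (IsGreatest (lt st) lo hi) →
        IsGreatest (lt st) lo hi (maxElem (lt st) lo hi) × maxElem (lt st) lo hi ≡ maxElem (ltBy τ) lo hi
      agree (m , greatest) = subst (IsGreatest (lt st) lo hi) (sym m≡) greatest , trans m≡ (sym m≡′)
        where
        m≡ : maxElem (lt st) lo hi ≡ m
        m≡ = maxElem-greatest (lt st) (λ {x} {y} → IsLinearExtension⇒asym extension {x} {y}) greatest
        m≡′ : maxElem (ltBy τ) lo hi ≡ m
        m≡′ = maxElem-greatest (ltBy τ) (ltBy-asym τ)
                (IsGreatest-⊆ (λ {x} {y} → IsLinearExtension⇒⊆ltBy extension {x} {y}) greatest)

    am-spec : isLRmin v ≡ false → IsGreatest (lt st) ℓ (pred i) am × am ≡ a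
    am-spec notLR = greatest-agrees (NearestSmallerLeft⇒Run 1≤i i≤ wi≡v (nearestLeft-spec notLR))

    bm-spec : isRLmin v ≡ false → IsGreatest (lt st) i (pred r) bm × bm ≡ b
    bm-spec notRL = greatest-agrees (NearestSmallerRight⇒Run 1≤i wi≡v (nearestRight-spec notRL))

    run-avoiding : ∀ {lo hi} → Run s lo hi → ¬ (lo < i × i ≤ hi) → Run (suc s) lo hi
    run-avoiding {lo} {hi} (1≤lo , lo≤hi , hi≤n , wlo≤s , whi≤s , between) i∉ =
      1≤lo , lo≤hi , hi≤n , m≤n⇒m≤1+n wlo≤s , m≤n⇒m≤1+n whi≤s , λ j lo<j j≤hi →
        ≤∧≢⇒< (between j lo<j j≤hi) λ v≡wj → i∉ (subst (λ p → lo < p × p ≤ hi)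
          (w-injective (≤-trans 1≤lo (<⇒≤ lo<j)) (≤-trans j≤hi (m≤n⇒m≤1+n hi≤n)) 1≤i i≤ (trans (sym v≡wj) (sym wi≡v)))
          (lo<j , j≤hi))

    run-containing : ∀ {lo hi} → Run s lo hi → lo < i → i ≤ hi →
      isLRmin v ≡ false × isRLmin v ≡ false × ℓ ≡ lo × r ≡ suc hi
    run-containing {lo} {hi} run@(1≤lo , _ , hi≤n , wlo≤s , whi≤s , _) lo<i i≤hi =
      notLR , notRL , NearestSmallerLeft-in-run run lo<i i≤hi (nearestLeft-spec notLR) ,
      NearestSmallerRight-in-run run lo<i i≤hi (nearestRight-spec notRL)
      where
      notLR : isLRmin v ≡ false
      notLR = ¬≡true⇒≡false _ λ LR → <⇒≱ (LRmin-above LR lo 1≤lo lo<i) (m≤n⇒m≤1+n wlo≤s)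
      notRL : isRLmin v ≡ false
      notRL = ¬≡true⇒≡false _ λ RL → <⇒≱ (RLmin-above RL (suc hi) (s≤s i≤hi) (s≤s hi≤n)) (m≤n⇒m≤1+n whi≤s)

    runs-extended : ∀ {lt′ : ℕ → ℕ → Bool} → (∀ {x y} → lt st x y ≡ true → lt′ x y ≡ true) →
      (isLRmin v ≡ false → isRLmin v ≡ false → ∃ (IsGreatest lt′ ℓ (pred r))) →
      ∀ {lo hi} → Run s lo hi → ∃ (IsGreatest lt′ lo hi)
    runs-extended {lt′} lt⊆lt′ merged {lo} {hi} run = by-position (lo <? i) (i ≤? hi)
      where
      unchanged : ¬ (lo < i × i ≤ hi) → ∃ (IsGreatest lt′ lo hi)
      unchanged i∉ = Product.map₂ (IsGreatest-⊆ (λ {x} {y} → lt⊆lt′ {x} {y})) (runs-greatest (run-avoiding run i∉))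
      containing : lo < i → i ≤ hi → ∃ (IsGreatest lt′ lo hi)
      containing lo<i i≤hi = merge (run-containing run lo<i i≤hi)
        where
        merge : isLRmin v ≡ false × isRLmin v ≡ false × ℓ ≡ lo × r ≡ suc hi → ∃ (IsGreatest lt′ lo hi)
        merge (notLR , notRL , ℓ≡lo , r≡hi) =
          subst₂ (λ lo′ r′ → ∃ (IsGreatest lt′ lo′ (pred r′))) ℓ≡lo r≡hi (merged notLR notRL)
      by-position : Dec (lo < i) → Dec (i ≤ hi) → ∃ (IsGreatest lt′ lo hi)
      by-position (yes lo<i) (yes i≤hi) = containing lo<i i≤hi
      by-position (no lo≮i) _ = unchanged (lo≮i ∘ proj₁)
      by-position (yes _) (no i≰hi) = unchanged (i≰hi ∘ proj₂)

    labelled-update : ∀ {c z} → c ≡ labelledBar v → z ≡ label v → Labelled s (update (lab st) c z)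
    labelled-update refl refl u s<u u≤ = by-value (m≤n⇒m<n∨m≡n s<u)
      where
      by-value : v < u ⊎ v ≡ u → update (lab st) (labelledBar v) (label v) (labelledBar u) ≡ label u
      by-value (inj₂ refl) = if-true (label v) (lab st (labelledBar v)) (≡⇒≡ᵇ≡true {labelledBar v} refl)
      by-value (inj₁ v<u) = trans (if-false (label v) (lab st (labelledBar u)) (≢⇒≡ᵇ≡false {labelledBar u} c≢)) (labelled u v<u u≤)
        where
        c≢ : labelledBar u ≢ labelledBar v
        c≢ cu≡cv = <⇒≢ v<u (sym (labelledBar-injective (≤-trans (s≤s 1≤s) s<u) u≤ (s≤s 1≤s) (s≤s s≤n) cu≡cv))

    private
      pick≡ : ∀ {A : Set} (x x′ : A) {L R y} → isLRmin v ≡ L → isRLmin v ≡ R → Y v ≡ y →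
        pick (isLRmin v) (isRLmin v) (Y v) x x′ ≡ pick L R y x x′
      pick≡ x x′ refl refl refl = refl

      bm-greatest : isRLmin v ≡ false → IsGreatest (lt st) (suc (pred i)) (pred r) bm
      bm-greatest notRL = subst (λ p → IsGreatest (lt st) p (pred r) bm) (sym (suc-pred′ 1≤i)) (proj₁ (bm-spec notRL))

    step-by-cases : ∀ L R y → isLRmin v ≡ L → isRLmin v ≡ R → Y v ≡ y →
      Invariant s (if L then record st { lab = update (lab st) bm (- (+ v)) }
                   else if R then record st { lab = update (lab st) am (+ v) }
                   else if y then record { lt = addCover (lt st) am bm ; lab = update (lab st) am (+ v) }
                   else record { lt = addCover (lt st) bm am ; lab = update (lab st) bm (- (+ v)) })
    step-by-cases true true _ LR RL _ = ⊥-elim (¬LRmin×RLmin LR RL)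
    step-by-cases true false _ LR notRL eY = record
      { extension = extension
      ; runs-greatest = runs-extended (λ x≺y → x≺y) λ notLR _ → ⊥-elim (not-¬ LR notLR)
      ; labelled = labelled-update (trans (proj₂ (bm-spec notRL)) (sym (pick≡ a b LR notRL eY)))
                                   (sym (pick≡ (+ v) (- (+ v)) LR notRL eY))
      }
    step-by-cases false true _ notLR RL eY = record
      { extension = extension
      ; runs-greatest = runs-extended (λ x≺y → x≺y) λ _ notRL → ⊥-elim (not-¬ RL notRL)
      ; labelled = labelled-update (trans (proj₂ (am-spec notLR)) (sym (pick≡ a b notLR RL eY)))
                                   (sym (pick≡ (+ v) (- (+ v)) notLR RL eY))
      }
    step-by-cases false false true notLR notRL v∈Y = record
      { extension = addCover-linearExtension (λ {x} {y} → extension {x} {y})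
          (subst₂ (λ x y → τ x < τ y) (sym (proj₂ (am-spec notLR))) (sym (proj₂ (bm-spec notRL))) (Y⇒left-first notLR notRL v∈Y))
      ; runs-greatest = runs-extended (λ {x} {y} → addCover-⊇ (lt st) am bm {x} {y}) λ _ _ →
          bm , addCover-greatestʳ (lt st) (proj₁ (am-spec notLR)) (bm-greatest notRL)
      ; labelled = labelled-update (trans (proj₂ (am-spec notLR)) (sym (pick≡ a b notLR notRL v∈Y)))
                                   (sym (pick≡ (+ v) (- (+ v)) notLR notRL v∈Y))
      }
    step-by-cases false false false notLR notRL v∉Y = record
      { extension = addCover-linearExtension (λ {x} {y} → extension {x} {y})
          (subst₂ (λ x y → τ x < τ y) (sym (proj₂ (bm-spec notRL))) (sym (proj₂ (am-spec notLR))) (¬Y⇒right-first notLR notRL v∉Y))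
      ; runs-greatest = runs-extended (λ {x} {y} → addCover-⊇ (lt st) bm am {x} {y}) λ _ _ →
          am , addCover-greatestˡ (lt st) (proj₁ (am-spec notLR)) (bm-greatest notRL)
      ; labelled = labelled-update (trans (proj₂ (bm-spec notRL)) (sym (pick≡ a b notLR notRL v∉Y)))
                                   (sym (pick≡ (+ v) (- (+ v)) notLR notRL v∉Y))
      }

    step-preserves : Invariant s (stepP n w Y st v)
    step-preserves = step-by-cases (isLRmin v) (isRLmin v) (Y v) refl refl refl

  initial : Invariant (suc n) initP
  initial = record
    { extension = λ ()
    ; runs-greatest = λ run → _ , single run
    ; labelled = λ u n<u u≤ → ⊥-elim (<⇒≱ n<u u≤)
    }
    where
    single : ∀ {lo hi} → Run (suc n) lo hi → IsGreatest (lt initP) lo hi lo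
    single {lo} {hi} (1≤lo , lo≤hi , hi≤n , _ , _ , between) with m≤n⇒m<n∨m≡n lo≤hi
    ... | inj₂ refl = ≤-refl , ≤-refl , λ y lo≤y y≤hi → inj₁ (≤-antisym y≤hi lo≤y)
    ... | inj₁ lo<hi = ⊥-elim (<⇒≱ (between hi lo<hi ≤-refl)
                                    (proj₂ (w-range hi (≤-trans 1≤lo lo≤hi) (m≤n⇒m≤1+n hi≤n))))

  fold-preserves : ∀ m st → m ≤ n → Invariant (suc m) st →
    Invariant 1 (foldl (stepP n w Y) st (applyDownFrom (λ t → 2 + t) m))
  fold-preserves zero st _ inv = inv
  fold-preserves (suc m) st m<n inv =
    fold-preserves m _ (≤-trans (n≤1+n m) m<n) (Step.step-preserves (suc m) (s≤s z≤n) m<n st inv)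

  final : Invariant 1 (buildP n w Y)
  final = subst (Invariant 1) (sym (cong (foldl (stepP n w Y) initP) (reverse-applyUpTo (λ t → 2 + t) n)))
                (fold-preserves n initP ≤-refl initial)

  labelledBar-surjective : ∀ {x} → 1 ≤ x → x ≤ n → ∃ λ u → 2 ≤ u × u ≤ suc n × labelledBar u ≡ x
  labelledBar-surjective {x} 1≤x x≤n = preimage (injective⇒surjective n f f-bound f-injective (<-≤-trans (≤pred⇒< 1≤x ≤-refl) x≤n))
    where
    spec : ∀ {t} → t < n → RemovalLabel (labelledBar (2 + t)) (label (2 + t))
    spec t<n = Value.labelledBar-spec _ (s≤s (s≤s z≤n)) (s≤s t<n)
    f : ℕ → ℕ
    f t = pred (labelledBar (2 + t))
    f-bound : ∀ {t} → t < n → f t < n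
    f-bound t<n = <-≤-trans (≤pred⇒< (proj₁ (spec t<n)) ≤-refl) (proj₁ (proj₂ (spec t<n)))
    f-injective : ∀ {s t} → s < n → t < n → f s ≡ f t → s ≡ t
    f-injective s<n t<n fs≡ft = suc-injective (suc-injective
      (labelledBar-injective (s≤s (s≤s z≤n)) (s≤s s<n) (s≤s (s≤s z≤n)) (s≤s t<n)
        (trans (sym (suc-pred′ (proj₁ (spec s<n)))) (trans (cong suc fs≡ft) (suc-pred′ (proj₁ (spec t<n)))))))
    preimage : (∃ λ t → t < n × f t ≡ pred x) → ∃ λ u → 2 ≤ u × u ≤ suc n × labelledBar u ≡ x
    preimage (t , t<n , ft≡x) = 2 + t , s≤s (s≤s z≤n) , s≤s t<n ,
      trans (sym (suc-pred′ (proj₁ (spec t<n)))) (trans (cong suc ft≡x) (suc-pred′ 1≤x))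

  buildP-linearExtension : IsLinearExtension τ (lt (buildP n w Y))
  buildP-linearExtension = Invariant.extension final

  lamN≡Λ∘σ : ∀ k → 1 ≤ k → k ≤ n → lamN n w σ k ≡ lab (buildP n w Y) (σ k)
  lamN≡Λ∘σ k 1≤k k≤n = via (labelledBar-surjective (proj₁ (σ-range k 1≤k k≤n)) (proj₂ (σ-range k 1≤k k≤n)))
    where
    open ≡-Reasoning
    via : (∃ λ u → 2 ≤ u × u ≤ suc n × labelledBar u ≡ σ k) → lamN n w σ k ≡ lab (buildP n w Y) (σ k)
    via (u , 2≤u , u≤ , c≡σk) = begin
      lamN n w σ k                       ≡⟨ cong (lamN n w σ) (τ∘σ k 1≤k k≤n) ⟨
      lamN n w σ (τ (σ k))               ≡⟨ cong (lamN n w σ ∘ τ) c≡σk ⟨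
      lamN n w σ (τ (labelledBar u))     ≡⟨ proj₂ (proj₂ (Value.labelledBar-spec u 2≤u u≤)) ⟩
      label u                            ≡⟨ Invariant.labelled final u 2≤u u≤ ⟨
      lab (buildP n w Y) (labelledBar u) ≡⟨ cong (lab (buildP n w Y)) c≡σk ⟩
      lab (buildP n w Y) (σ k)           ∎

oneLine-suc : ∀ m (π : Permutation′ m) {p} (p<m : p < m) → oneLine m π (suc p) ≡ suc (toℕ (π ⟨$⟩ʳ fromℕ< p<m))
oneLine-suc m π {p} p<m with p <? m
... | yes _ = refl
... | no p≮m = ⊥-elim (p≮m p<m)

oneLine-toℕ : ∀ m (π : Permutation′ m) t → oneLine m π (suc (toℕ t)) ≡ suc (toℕ (π ⟨$⟩ʳ t))
oneLine-toℕ m π t =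
  trans (oneLine-suc m π (Fin.toℕ<n t)) (cong (λ t′ → suc (toℕ (π ⟨$⟩ʳ t′))) (Fin.fromℕ<-toℕ t (Fin.toℕ<n t)))

oneLine-range : ∀ m (π : Permutation′ m) p → 1 ≤ p → p ≤ m → 1 ≤ oneLine m π p × oneLine m π p ≤ m
oneLine-range m π (suc p) _ p<m rewrite oneLine-suc m π p<m = s≤s z≤n , Fin.toℕ<n _

oneLine-inverse : ∀ m (π : Permutation′ m) p → 1 ≤ p → p ≤ m → oneLine m (flip π) (oneLine m π p) ≡ p
oneLine-inverse m π (suc p) _ p<m = begin
  oneLine m (flip π) (oneLine m π (suc p))           ≡⟨ cong (oneLine m (flip π)) (oneLine-suc m π p<m) ⟩
  oneLine m (flip π) (suc (toℕ (π ⟨$⟩ʳ fromℕ< p<m))) ≡⟨ oneLine-toℕ m (flip π) _ ⟩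
  suc (toℕ (π ⟨$⟩ˡ (π ⟨$⟩ʳ fromℕ< p<m)))             ≡⟨ cong (suc ∘ toℕ) (inverseˡ π) ⟩
  suc (toℕ (fromℕ< p<m))                             ≡⟨ cong suc (Fin.toℕ-fromℕ< p<m) ⟩
  suc p                                              ∎
  where open ≡-Reasoning

oneLine-injective : ∀ m (π : Permutation′ m) {p q} → 1 ≤ p → p ≤ m → 1 ≤ q → q ≤ m →
  oneLine m π p ≡ oneLine m π q → p ≡ q
oneLine-injective m π {p} {q} 1≤p p≤m 1≤q q≤m πp≡πq = begin
  p                                  ≡⟨ oneLine-inverse m π p 1≤p p≤m ⟨
  oneLine m (flip π) (oneLine m π p) ≡⟨ cong (oneLine m (flip π)) πp≡πq ⟩
  oneLine m (flip π) (oneLine m π q) ≡⟨ oneLine-inverse m π q 1≤q q≤m ⟩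
  q                                  ∎
  where open ≡-Reasoning

oneLine-surjective : ∀ m (π : Permutation′ m) v → 1 ≤ v → v ≤ m → ∃ λ p → 1 ≤ p × p ≤ m × oneLine m π p ≡ v
oneLine-surjective m π v 1≤v v≤m =
  oneLine m (flip π) v , proj₁ (oneLine-range m (flip π) v 1≤v v≤m) , proj₂ (oneLine-range m (flip π) v 1≤v v≤m) ,
  oneLine-inverse m (flip π) v 1≤v v≤m

proposition2p9 : (n : ℕ) → 1 ≤ n → (w : Permutation′ (suc n)) → (σ : Permutation′ n) →
    ((a b : Fin n) → _≺P_ n w σ (bar a) (bar b) → toℕ (σ ⟨$⟩ˡ a) < toℕ (σ ⟨$⟩ˡ b))
    × ((k : Fin n) → lam n w σ k ≡ Λ n w σ (bar (σ ⟨$⟩ʳ k)))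
proposition2p9 n _ w σ = linear-extension , labels
  where
  open Removals n (oneLine (suc n) w) (oneLine n σ) (oneLine n (flip σ))
    (oneLine-range (suc n) w) (oneLine-injective (suc n) w) (oneLine-surjective (suc n) w)
    (oneLine-range n σ) (oneLine-range n (flip σ)) (oneLine-inverse n (flip σ)) (oneLine-inverse n σ)

  linear-extension : (a b : Fin n) → _≺P_ n w σ (bar a) (bar b) → toℕ (σ ⟨$⟩ˡ a) < toℕ (σ ⟨$⟩ˡ b)
  linear-extension a b a≺b = s<s⁻¹ (subst₂ _<_ (oneLine-toℕ n (flip σ) a) (oneLine-toℕ n (flip σ) b)
    (buildP-linearExtension (T⇒≡true a≺b)))

  labels : (k : Fin n) → lam n w σ k ≡ Λ n w σ (bar (σ ⟨$⟩ʳ k))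
  labels k = trans (lamN≡Λ∘σ (bar k) (s≤s z≤n) (Fin.toℕ<n k)) (cong (lab (PwY n w σ)) (oneLine-toℕ n σ k))
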